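{- Let $r,u,m,n,k\in\mathbb{N}$ and $i\in\{0,1\}$. Then (1) $D_k(r,u,m,n)=\left[\begin{array}{c}r\\k\end{array}\right]D_{r,u,m}(n)$; (2) $D(r,u,m,n)=r!\,D_{r,u,m}(n)$; (3) $D^{(i)}(r,u,m,n)=\frac{r!}{2}D_{r,u,m}(n)$ if $r\ge 2$, and $D^{(i)}(r,u,m,n)=D^{(i)}_{r,u,m}(n)$ if $r\in\{0,1\}$; (4) $D_k^{(i)}(r,u,m,n)=\left[\begin{array}{c}r\\k\end{array}\right]D^{((r+k+i)\bmod 2)}_{r,u,m}(n)$.
   Context: $\mathbb{N}$ denotes the non-negative integers and $\mathcal{S}_N$ the set of permutations of $\{1,\ldots,N\}$. For a permutation $\sigma$, $\mathrm{par}\,\sigma=0$ if $\sigma$ is even and $1$ if odd. Cycles are those of the disjoint cycle decomposition, fixed points counted as 1-cycles. $\mathcal{D}(r,u,m,n)$ is the set of $\sigma\in\mathcal{S}_{r+n}$ such that there are exactly $u$ elements $x\in\{1,\ldots,r\}$ with $\sigma(x)\in\{1,\ldots,r\}$, and exactly $m$ elements $t\in\{r+1,\ldots,r+n\}$ with $\sigma(t)=t$. $D(r,u,m,n)=\#\mathcal{D}(r,u,m,n)$. $D_k(r,u,m,n)$ is the number of $\sigma\in\mathcal{D}(r,u,m,n)$ having exactly $k$ cycles containing at least one element of $\{1,\ldots,r\}$; $D^{(i)}(r,u,m,n)$ is the number of $\sigma\in\mathcal{D}(r,u,m,n)$ with $\mathrm{par}\,\sigma=i$; $D^{(i)}_k(r,u,m,n)$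 is the number of $\sigma\in\mathcal{D}(r,u,m,n)$ with both properties. $\mathcal{D}_{r,u,m}(n)$ is the set of $\sigma\in\mathcal{S}_{r+n}$ such that any two distinct elements of $\{1,\ldots,r\}$ lie in different cycles of $\sigma$, exactly $u$ elements of $\{1,\ldots,r\}$ are fixed by $\sigma$, and exactly $m$ elements of $\{r+1,\ldots,r+n\}$ are fixed by $\sigma$. $D_{r,u,m}(n)=\#\mathcal{D}_{r,u,m}(n)$ and $D^{(i)}_{r,u,m}(n)$ is the number of its elements of parity $i$. $\left[\begin{array}{c}r\\k\end{array}\right]$ is the unsigned Stirling number of the first kind: the number of permutations of $\{1,\ldots,r\}$ with exactly $k$ cycles (equivalently, $\prod_{j=0}^{r-1}(x+j)=\sum_k \left[\begin{array}{c}r\\k\end{array}\right]x^k$). -}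

module Defs where

open import Data.Bool using (Bool; true; false; _∧_; _∨_; not; if_then_else_)
open import Data.Nat using (ℕ; zero; suc; _+_; _*_; _<ᵇ_; _≡ᵇ_; _%_)
open import Data.Fin using (Fin; toℕ)
open import Data.Vec using (Vec; []; _∷_; lookup)
open import Data.List using (upTo; List; [_]; map; concatMap; allFin; length; filter)
open import Data.Bool.ListAction using (any; all)
open import Data.Nat.ListAction using (sum)
open import Data.Bool.Properties using (T?)

-- Conventions: the element x ∈ {1,…,N} of the paper is represented by
-- the element (x - 1) : Fin N.  So {1,…,r} ⊆ {1,…,r+n} corresponds to
-- { x : Fin (r + n) | toℕ x < r }.

-- A candidate permutation of Fin N is its table of values
-- (σ(0), …, σ(N-1)); it is a permutation iff it is injective.
Table : ℕ → Set
Table N = Vec (Fin N) N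

_≟ᶠ_ : {N : ℕ} → Fin N → Fin N → Bool
x ≟ᶠ y = toℕ x ≡ᵇ toℕ y

anyFin : (N : ℕ) → (Fin N → Bool) → Bool
anyFin N p = any p (allFin N)

allFin? : (N : ℕ) → (Fin N → Bool) → Bool
allFin? N p = all p (allFin N)

countFin : (N : ℕ) → (Fin N → Bool) → ℕ
countFin N p = sum (map (λ x → if p x then 1 else 0) (allFin N))

allTables : (k N : ℕ) → List (Vec (Fin N) k)
allTables zero N = [ [] ]
allTables (suc k) N = concatMap (λ x → map (x ∷_) (allTables k N)) (allFin N)

isPerm : {N : ℕ} → Table N → Bool
isPerm {N} σ = allFin? N (λ x → allFin? N (λ y →
  not (lookup σ x ≟ᶠ lookup σ y) ∨ (x ≟ᶠ y)))

perms : (N : ℕ) → List (Table N)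
perms N = filter (λ σ → T? (isPerm σ)) (allTables N N)

countPerms : (N : ℕ) → (Table N → Bool) → ℕ
countPerms N P = length (filter (λ σ → T? (P σ)) (perms N))

iter : {N : ℕ} → Table N → ℕ → Fin N → Fin N
iter σ zero x = x
iter σ (suc j) x = lookup σ (iter σ j x)

-- x and y lie in the same cycle of σ: y = σ^j(x) for some j
-- (j < N suffices since every cycle has length ≤ N).
sameCycle : {N : ℕ} → Table N → Fin N → Fin N → Bool
sameCycle {N} σ x y = any (λ j → iter σ j x ≟ᶠ y) (upTo N)

-- number of cycles of σ containing at least one element of
-- {0,…,r-1} (i.e. of the paper's {1,…,r}); each such cycle is counted
-- once, via its least element lying in {0,…,r-1}.
cyclesMeeting : {N : ℕ} → ℕ → Table N → ℕ
cyclesMeeting {N} r σ = countFin N (λ x → (toℕ x <ᵇ r) ∧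
  not (anyFin N (λ y → (toℕ y <ᵇ toℕ x) ∧ sameCycle σ y x)))

-- total number of cycles (fixed points count as 1-cycles)
numCycles : {N : ℕ} → Table N → ℕ
numCycles {N} σ = cyclesMeeting N σ

inversions : {N : ℕ} → Table N → ℕ
inversions {N} σ = sum (map (λ x → countFin N (λ y →
  (toℕ x <ᵇ toℕ y) ∧ (toℕ (lookup σ y) <ᵇ toℕ (lookup σ x)))) (allFin N))

par : {N : ℕ} → Table N → ℕ
par σ = inversions σ % 2

stayInR : {N : ℕ} → ℕ → Table N → ℕ
stayInR {N} r σ = countFin N (λ x → (toℕ x <ᵇ r) ∧ (toℕ (lookup σ x) <ᵇ r))

fixedInR : {N : ℕ} → ℕ → Table N → ℕ
fixedInR {N} r σ = countFin N (λ x → (toℕ x <ᵇ r) ∧ (lookup σ x ≟ᶠ x))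

fixedOutR : {N : ℕ} → ℕ → Table N → ℕ
fixedOutR {N} r σ = countFin N (λ x → not (toℕ x <ᵇ r) ∧ (lookup σ x ≟ᶠ x))

inD : (r u m n : ℕ) → Table (r + n) → Bool
inD r u m n σ = (stayInR r σ ≡ᵇ u) ∧ (fixedOutR r σ ≡ᵇ m)

inDsep : (r u m n : ℕ) → Table (r + n) → Bool
inDsep r u m n σ =
  allFin? (r + n) (λ x → allFin? (r + n) (λ y →
    not ((toℕ x <ᵇ r) ∧ (toℕ y <ᵇ r) ∧ not (x ≟ᶠ y)) ∨ not (sameCycle σ x y)))
  ∧ (fixedInR r σ ≡ᵇ u) ∧ (fixedOutR r σ ≡ᵇ m)

D : (r u m n : ℕ) → ℕ
D r u m n = countPerms (r + n) (inD r u m n)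

Dk : (k r u m n : ℕ) → ℕ
Dk k r u m n = countPerms (r + n) (λ σ → inD r u m n σ ∧ (cyclesMeeting r σ ≡ᵇ k))

Dpar : (i r u m n : ℕ) → ℕ
Dpar i r u m n = countPerms (r + n) (λ σ → inD r u m n σ ∧ (par σ ≡ᵇ i))

Dkpar : (i k r u m n : ℕ) → ℕ
Dkpar i k r u m n = countPerms (r + n)
  (λ σ → inD r u m n σ ∧ (cyclesMeeting r σ ≡ᵇ k) ∧ (par σ ≡ᵇ i))

Dsep : (r u m n : ℕ) → ℕ
Dsep r u m n = countPerms (r + n) (inDsep r u m n)

Dseppar : (i r u m n : ℕ) → ℕ
Dseppar i r u m n = countPerms (r + n) (λ σ → inDsep r u m n σ ∧ (par σ ≡ᵇ i))

stirling1 : ℕ → ℕ → ℕ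
stirling1 r k = countPerms r (λ σ → numCycles σ ≡ᵇ k)

-- Every permutation of {0,…,N} arises exactly once from a permutation σ of
-- {0,…,N-1} by inserting the new point N, either as a fixed point or right after some a in
-- the cycle of a.  When N lies outside R = {0,…,r-1}, such an insertion changes neither the
-- cycles meeting R nor which points of R share a cycle, it flips the parity unless N becomes
-- a fixed point, and it removes exactly the contribution of a to the statistic at hand
-- (a step R → R for D, a fixed point in R for Dsep) or to the number of fixed points outside
-- R.  Hence both kinds of counts, as functions of n, satisfy the same linear recurrence and
-- are proportional as soon as they are so for n = 0.  There every permutation of R maps R to
-- R while the identity is the only separated one, so the factor is the number of
-- permutations of R with the extra property: a Stirling number, r!, or r!/2 (the parities
-- are balanced once r ≥ 2); for (4) one uses par σ ≡ r + #cycles σ (mod 2).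

module Submission where

open import Defs
open import Data.Nat.Properties hiding (_≟_)
open import Algebra.Properties.CommutativeMonoid.Sum +-0-commutativeMonoid
  using (sum-syntax; sum-cong-≗; sum-init-last; sum-remove; sum-replicate-zero; ∑-distrib-+)
  renaming (sum to ∑)
open import Algebra.Properties.CommutativeSemigroup *-commutativeSemigroup using (x∙yz≈y∙xz)
open import Algebra.Properties.CommutativeSemigroup +-commutativeSemigroup using (interchange)
open import Data.Bool using (Bool; true; false; _∧_; _∨_; not; if_then_else_; T)
open import Data.Bool.Properties
  using (T?; T-∧; T-≡; T-not-≡; ⇔→≡; ∧-assoc; ∧-comm; ∧-zeroʳ; ∧-identityʳ; ∨-identityʳ; ∨-zeroʳ; not-involutive)
open import Data.Fin using (Fin; toℕ; fromℕ; inject₁; lower₁; punchIn)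
open import Data.Fin.Properties as Fin
  using (_≟_; toℕ-fromℕ; toℕ-inject₁; toℕ<n; toℕ-injective; fromℕ≢inject₁; inject₁-injective; inject₁-lower₁)
open import Data.Fin.Permutation.Components using (transpose)
open import Data.Fin.Relation.Unary.Top using (view; ‵fromℕ; ‵inj₁; view-fromℕ; view-inject₁)
open import Data.List using (List; []; _∷_; map; allFin; length; filter; upTo; cartesianProductWith; concatMap; _++_)
import Data.List as List
import Data.List.Properties as List
open import Data.List.Membership.Propositional using (_∈_; lose)
open import Data.List.Membership.Propositional.Properties
  using (∈-allFin; ∈-upTo⁺; ∈-filter⁺; ∈-filter⁻; ∈-cartesianProductWith⁺; ∈-cartesianProductWith⁻)
open import Data.List.Membership.Propositional.Properties.WithK using (unique∧set⇒bag)
open import Data.List.Relation.Binary.BagAndSetEquality using (∼bag⇒↭)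
open import Data.List.Relation.Binary.Permutation.Propositional using (_↭_)
import Data.List.Relation.Binary.Permutation.Propositional.Properties as ↭
import Data.List.Relation.Unary.All as All
open import Data.List.Relation.Unary.All.Properties using (all⁺; all⁻)
open import Data.List.Relation.Unary.AllPairs using ([]; _∷_)
open import Data.List.Relation.Unary.Any using (here; there; satisfied)
open import Data.List.Relation.Unary.Any.Properties using (any⁺; any⁻)
open import Data.List.Relation.Unary.Unique.Propositional using (Unique)
import Data.List.Relation.Unary.Unique.Propositional.Properties as Unique
open import Data.Nat using (ℕ; zero; suc; _+_; _*_; _∸_; _<_; _≤_; _≥_; _<ᵇ_; _≡ᵇ_; _<?_; _%_; _/_; _!; s≤s; z≤n; s≤s⁻¹)
open import Data.Nat.DivMod using (m≡m%n+[m/n]*n; m%n<n; %-distribˡ-+; [m+n]%n≡m%n; [m+kn]%n≡m%n; m*n/n≡m; m<n⇒m%n≡m)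
open import Data.Nat.ListAction using (sum)
open import Data.Nat.ListAction.Properties using (sum-↭; sum-++)
open import Data.Nat.Tactic.RingSolver using (solve-∀)
open import Data.Product using (_×_; _,_; proj₁; proj₂; ∃; ∃₂; ∃-syntax)
open import Data.Sum using (_⊎_; inj₁; inj₂)
open import Data.Unit using (tt)
open import Data.Vec using (Vec; []; _∷_; lookup; tabulate) renaming (allFin to identity)
import Data.Vec.Properties as Vec
open import Data.Vec.Properties using (lookup-allFin)
open import Function using (_∘_; id; const; _⇔_; mk⇔; Equivalence)
import Function.Properties.Equivalence as ⇔
open import Function.Definitions using (Injective)
open import Relation.Binary.Definitions using (tri<; tri≈; tri>)
open import Relation.Binary.PropositionalEquality
open import Relation.Nullary using (Dec; yes; no; ¬_)
open import Relation.Nullary.Decidable using (dec-true; dec-false)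
open import Relation.Nullary.Negation using (contradiction)

open Equivalence
open ≡-Reasoning

𝟙 : Bool → ℕ
𝟙 b = if b then 1 else 0

𝟙-∧ : ∀ x y → 𝟙 (x ∧ y) ≡ 𝟙 x * 𝟙 y
𝟙-∧ true  y = sym (+-identityʳ (𝟙 y))
𝟙-∧ false y = refl

¬T⇒≡false : ∀ {b} → ¬ T b → b ≡ false
¬T⇒≡false {false} _  = refl
¬T⇒≡false {true}  ¬t = contradiction _ ¬t

𝟙-¬T : ∀ {b} → ¬ T b → 𝟙 b ≡ 0
𝟙-¬T = cong 𝟙 ∘ ¬T⇒≡false

T⇔T⇒≡ : ∀ {x y} → T x ⇔ T y → x ≡ y
T⇔T⇒≡ h = ⇔→≡ (⇔.trans (⇔.sym T-≡) (⇔.trans h T-≡))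

<ᵇ-true : ∀ {m n} → m < n → (m <ᵇ n) ≡ true
<ᵇ-true {m} {n} = dec-true (m <? n)

<ᵇ-false : ∀ {m n} → n ≤ m → (m <ᵇ n) ≡ false
<ᵇ-false {m} {n} n≤m = dec-false (m <? n) (≤⇒≯ n≤m)

≡ᵇ-refl : ∀ i → (i ≡ᵇ i) ≡ true
≡ᵇ-refl i = to T-≡ (≡⇒≡ᵇ i i refl)

𝟙-<ᵇ-split : ∀ b {m n} → m ≢ n → 𝟙 (b ∧ (m <ᵇ n)) + 𝟙 (b ∧ (n <ᵇ m)) ≡ 𝟙 b
𝟙-<ᵇ-split false m≢n = refl
𝟙-<ᵇ-split true {m} {n} m≢n with <-cmp m n
... | tri< m<n _ _ = cong₂ _+_ (cong 𝟙 (<ᵇ-true m<n)) (cong 𝟙 (<ᵇ-false (<⇒≤ m<n)))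
... | tri≈ _ m≡n _ = contradiction m≡n m≢n
... | tri> _ _ n<m = cong₂ _+_ (cong 𝟙 (<ᵇ-false (<⇒≤ n<m))) (cong 𝟙 (<ᵇ-true n<m))

≟ᶠ-reflects : ∀ {N} {x y : Fin N} → T (x ≟ᶠ y) ⇔ x ≡ y
≟ᶠ-reflects {x = x} {y} = mk⇔ (Fin.toℕ-injective ∘ ≡ᵇ⇒≡ (toℕ x) (toℕ y)) (≡⇒≡ᵇ (toℕ x) (toℕ y) ∘ cong toℕ)

T-allFin? : ∀ {N} (p : Fin N → Bool) → T (allFin? N p) ⇔ (∀ x → T (p x))
T-allFin? {N} p = mk⇔ (λ t x → All.lookup (all⁺ p (allFin N) t) (∈-allFin x))
                        (λ h → all⁻ p {allFin N} (All.tabulate λ {x} _ → h x))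

T-anyFin : ∀ {N} (p : Fin N → Bool) → T (anyFin N p) ⇔ ∃ (T ∘ p)
T-anyFin {N} p = mk⇔ (satisfied ∘ any⁻ p (allFin N)) (λ (x , px) → any⁺ p (lose (∈-allFin x) px))

count : {A : Set} → (A → Bool) → List A → ℕ
count P xs = sum (map (𝟙 ∘ P) xs)

module _ {A : Set} where

  length-filter-T? : (P : A → Bool) (xs : List A) → length (filter (T? ∘ P) xs) ≡ count P xs
  length-filter-T? P []       = refl
  length-filter-T? P (x ∷ xs) with P x
  ... | true  = cong suc (length-filter-T? P xs)
  ... | false = length-filter-T? P xs

  sum-map-cong : (xs : List A) {f g : A → ℕ} → (∀ {x} → x ∈ xs → f x ≡ g x) → sum (map f xs) ≡ sum (map g xs)
  sum-map-cong []       f≗g = refl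
  sum-map-cong (x ∷ xs) f≗g = cong₂ _+_ (f≗g (here refl)) (sum-map-cong xs (f≗g ∘ there))

  sum-map-zero : (xs : List A) {f : A → ℕ} → (∀ {x} → x ∈ xs → f x ≡ 0) → sum (map f xs) ≡ 0
  sum-map-zero []       f≡0 = refl
  sum-map-zero (x ∷ xs) f≡0 = cong₂ _+_ (f≡0 (here refl)) (sum-map-zero xs (f≡0 ∘ there))

  sum-map-+ : (xs : List A) (f g : A → ℕ) → sum (map (λ x → f x + g x) xs) ≡ sum (map f xs) + sum (map g xs)
  sum-map-+ []       f g = refl
  sum-map-+ (x ∷ xs) f g =
    trans (cong (f x + g x +_) (sum-map-+ xs f g)) (interchange (f x) (g x) _ _)

  sum-map-* : (xs : List A) (c : ℕ) (f : A → ℕ) → sum (map (λ x → c * f x) xs) ≡ c * sum (map f xs)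
  sum-map-* []       c f = sym (*-zeroʳ c)
  sum-map-* (x ∷ xs) c f = trans (cong (c * f x +_) (sum-map-* xs c f)) (sym (*-distribˡ-+ c (f x) _))

  sum-map-↭ : (f : A → ℕ) {xs ys : List A} → xs ↭ ys → sum (map f xs) ≡ sum (map f ys)
  sum-map-↭ f = sum-↭ ∘ ↭.map⁺ f

count-cong : ∀ {A : Set} {P Q : A → Bool} (xs : List A) → (∀ x → P x ≡ Q x) → count P xs ≡ count Q xs
count-cong xs P≗Q = sum-map-cong xs (λ {x} _ → cong 𝟙 (P≗Q x))

count-unique : ∀ {A : Set} (P : A → Bool) {xs : List A} {z} → Unique xs → z ∈ xs →
               (∀ {y} → y ∈ xs → T (P y) → y ≡ z) → count P xs ≡ 𝟙 (P z)
count-unique P {x ∷ xs} (x∉xs ∷ xs!) (here refl) only =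
  trans (cong (𝟙 (P x) +_) (sum-map-zero xs (λ y∈xs → 𝟙-¬T (λ Py → All.lookup x∉xs y∈xs (sym (only (there y∈xs) Py))))))
        (+-identityʳ _)
count-unique P {x ∷ xs} (x∉xs ∷ xs!) (there z∈xs) only =
  cong₂ _+_ (𝟙-¬T (λ Px → All.lookup x∉xs z∈xs (only (here refl) Px))) (count-unique P xs! z∈xs (only ∘ there))

sum-tabulate : ∀ {N} (f : Fin N → ℕ) → sum (List.tabulate f) ≡ ∑[ i < N ] f i
sum-tabulate {zero}  f = refl
sum-tabulate {suc N} f = cong (f Fin.zero +_) (sum-tabulate (f ∘ Fin.suc))

sum-map-allFin : ∀ {N} (f : Fin N → ℕ) → sum (map f (allFin N)) ≡ ∑[ i < N ] f i
sum-map-allFin f = trans (cong sum (List.map-tabulate id f)) (sum-tabulate f)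

∑-distribˡ-* : ∀ {N} c (f : Fin N → ℕ) → ∑[ i < N ] (c * f i) ≡ c * ∑[ i < N ] f i
∑-distribˡ-* {zero}  c f = sym (*-zeroʳ c)
∑-distribˡ-* {suc N} c f =
  trans (cong (c * f Fin.zero +_) (∑-distribˡ-* c (f ∘ Fin.suc))) (sym (*-distribˡ-+ c _ _))

∑-const : ∀ N c → ∑[ i < N ] c ≡ N * c
∑-const zero    c = refl
∑-const (suc N) c = cong (c +_) (∑-const N c)

∑-0 : ∀ N → ∑[ i < N ] 0 ≡ 0
∑-0 = sum-replicate-zero

∑-except : ∀ {N} (f g : Fin N → ℕ) a → (∀ x → x ≢ a → f x ≡ g x) →
           ∑[ i < N ] f i + g a ≡ ∑[ i < N ] g i + f a
∑-except {suc N} f g a f≗g = begin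
  ∑ f + g a                      ≡⟨ cong (_+ g a) (sum-remove {i = a} f) ⟩
  f a + ∑ (f ∘ punchIn a) + g a  ≡⟨ cong (λ s → f a + s + g a) (sum-cong-≗ λ x → f≗g (punchIn a x) (Fin.punchInᵢ≢i a x)) ⟩
  f a + ∑ (g ∘ punchIn a) + g a  ≡⟨ swap-ends (f a) _ (g a) ⟩
  g a + ∑ (g ∘ punchIn a) + f a  ≡⟨ cong (_+ f a) (sum-remove {i = a} g) ⟨
  ∑ g + f a                      ∎
  where
  swap-ends : ∀ x s y → x + s + y ≡ y + s + x
  swap-ends = solve-∀

countFin-suc : ∀ {N} (f : Fin (suc N) → Bool) → countFin (suc N) f ≡ ∑[ x < N ] 𝟙 (f (inject₁ x)) + 𝟙 (f (fromℕ N))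
countFin-suc f = trans (sum-map-allFin (𝟙 ∘ f)) (sum-init-last (𝟙 ∘ f))

countFin-cong : ∀ {N} {p q : Fin N → Bool} → (∀ x → p x ≡ q x) → countFin N p ≡ countFin N q
countFin-cong {N} p≗q = cong sum (List.map-cong (cong 𝟙 ∘ p≗q) (allFin N))

countFin-all : ∀ {M} {p : Fin M → Bool} → (∀ x → T (p x)) → countFin M p ≡ M
countFin-all {M} all = trans (countFin-cong {q = const true} (λ x → to T-≡ (all x)))
  (trans (sum-map-allFin {M} (const 1)) (trans (∑-const M 1) (*-identityʳ M)))

countFin-none : ∀ {M} {p : Fin M → Bool} → (∀ x → ¬ T (p x)) → countFin M p ≡ 0
countFin-none {M} none = sum-map-zero (allFin M) (λ {x} _ → 𝟙-¬T (none x))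

∑-distribʳ-* : ∀ {N} c (f : Fin N → ℕ) → ∑[ i < N ] (f i * c) ≡ ∑[ i < N ] f i * c
∑-distribʳ-* {N} c f = trans (sum-cong-≗ (λ i → *-comm (f i) c)) (trans (∑-distribˡ-* c f) (*-comm c _))

sum-map-unique : ∀ {A : Set} (f : A → ℕ) {xs ys : List A} → Unique xs → Unique ys →
                 (∀ {z} → z ∈ xs ⇔ z ∈ ys) → sum (map f xs) ≡ sum (map f ys)
sum-map-unique f xs! ys! xs≈ys = sum-map-↭ f (∼bag⇒↭ (unique∧set⇒bag xs! ys! xs≈ys))

IsPerm : ∀ {N} → Table N → Set
IsPerm σ = Injective _≡_ _≡_ (lookup σ)

lookup-ext : ∀ {A : Set} {n} {u v : Vec A n} → (∀ i → lookup u i ≡ lookup v i) → u ≡ v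
lookup-ext {u = u} {v} u≗v = trans (sym (Vec.tabulate∘lookup u)) (trans (Vec.tabulate-cong u≗v) (Vec.tabulate∘lookup v))

isPerm-reflects : ∀ {N} (σ : Table N) → T (isPerm σ) ⇔ IsPerm σ
isPerm-reflects {N} σ = mk⇔ injective (λ inj → from (T-allFin? _) λ x → from (T-allFin? _) λ y → check inj x y)
  where
  injective : T (isPerm σ) → IsPerm σ
  injective t {x} {y} σx≡σy = to ≟ᶠ-reflects (subst (λ b → T (not b ∨ (x ≟ᶠ y)))
    (to T-≡ (from ≟ᶠ-reflects σx≡σy)) (to (T-allFin? _) (to (T-allFin? _) t x) y))
  check : IsPerm σ → ∀ x y → T (not (lookup σ x ≟ᶠ lookup σ y) ∨ (x ≟ᶠ y))
  check inj x y with lookup σ x ≟ᶠ lookup σ y in e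
  ... | false = tt
  ... | true  = from ≟ᶠ-reflects (inj (to ≟ᶠ-reflects (subst T (sym e) tt)))

allTables-suc : ∀ k N → allTables (suc k) N ≡ cartesianProductWith _∷_ (allFin N) (allTables k N)
allTables-suc k N = go (allFin N)
  where
  go : ∀ xs → concatMap (λ x → map (x ∷_) (allTables k N)) xs ≡ cartesianProductWith _∷_ xs (allTables k N)
  go []       = refl
  go (x ∷ xs) = cong (map (x ∷_) (allTables k N) ++_) (go xs)

allTables-unique : ∀ k N → Unique (allTables k N)
allTables-unique zero    N = All.[] ∷ []
allTables-unique (suc k) N rewrite allTables-suc k N =
  Unique.cartesianProductWith⁺ _∷_ Vec.∷-injective (Unique.allFin⁺ N) (allTables-unique k N)

∈-allTables : ∀ k N (v : Vec (Fin N) k) → v ∈ allTables k N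
∈-allTables zero    N []      = here refl
∈-allTables (suc k) N (x ∷ v) rewrite allTables-suc k N =
  ∈-cartesianProductWith⁺ _∷_ (∈-allFin x) (∈-allTables k N v)

perms-unique : ∀ N → Unique (perms N)
perms-unique N = Unique.filter⁺ (T? ∘ isPerm) (allTables-unique N N)

∈-perms : ∀ {N} {σ : Table N} → σ ∈ perms N ⇔ IsPerm σ
∈-perms {N} {σ} = mk⇔
  (to (isPerm-reflects σ) ∘ proj₂ ∘ ∈-filter⁻ (T? ∘ isPerm) {xs = allTables N N})
  (∈-filter⁺ (T? ∘ isPerm) (∈-allTables N N σ) ∘ from (isPerm-reflects σ))

module _ {n : ℕ} where

  transpose-matchˡ : (i j : Fin n) → transpose i j i ≡ j
  transpose-matchˡ i j rewrite dec-true (i ≟ i) refl = refl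

  transpose-matchʳ : (i j : Fin n) → transpose i j j ≡ i
  transpose-matchʳ i j with j ≟ i
  ... | yes j≡i = j≡i
  ... | no  _   rewrite dec-true (j ≟ j) refl = refl

  transpose-other : {i j k : Fin n} → k ≢ i → k ≢ j → transpose i j k ≡ k
  transpose-other {i} {j} {k} k≢i k≢j rewrite dec-false (k ≟ i) k≢i | dec-false (k ≟ j) k≢j = refl

  transpose-involutive : (i j k : Fin n) → transpose i j (transpose i j k) ≡ k
  transpose-involutive i j k = cases (k ≟ i) (k ≟ j)
    where
    cases : Dec (k ≡ i) → Dec (k ≡ j) → transpose i j (transpose i j k) ≡ k
    cases (yes k≡i) _ = begin
      transpose i j (transpose i j k) ≡⟨ cong (transpose i j ∘ transpose i j) k≡i ⟩
      transpose i j (transpose i j i) ≡⟨ cong (transpose i j) (transpose-matchˡ i j) ⟩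
      transpose i j j                 ≡⟨ transpose-matchʳ i j ⟩
      i                               ≡⟨ k≡i ⟨
      k                               ∎
    cases (no _) (yes k≡j) = begin
      transpose i j (transpose i j k) ≡⟨ cong (transpose i j ∘ transpose i j) k≡j ⟩
      transpose i j (transpose i j j) ≡⟨ cong (transpose i j) (transpose-matchʳ i j) ⟩
      transpose i j i                 ≡⟨ transpose-matchˡ i j ⟩
      j                               ≡⟨ k≡j ⟨
      k                               ∎
    cases (no k≢i) (no k≢j) =
      trans (cong (transpose i j) (transpose-other k≢i k≢j)) (transpose-other k≢i k≢j)

  transpose-injective : (i j : Fin n) {k l : Fin n} → transpose i j k ≡ transpose i j l → k ≡ l
  transpose-injective i j {k} {l} e =
    trans (sym (transpose-involutive i j k)) (trans (cong (transpose i j) e) (transpose-involutive i j l))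

module _ {N : ℕ} where

  extend : (Fin N → Fin N) → Fin (suc N) → Fin (suc N)
  extend f X with view X
  ... | ‵fromℕ     = fromℕ N
  ... | ‵inj₁ {i = x} _ = inject₁ (f x)

  extend-fromℕ : (f : Fin N → Fin N) → extend f (fromℕ N) ≡ fromℕ N
  extend-fromℕ f rewrite view-fromℕ N = refl

  extend-inject₁ : (f : Fin N → Fin N) (x : Fin N) → extend f (inject₁ x) ≡ inject₁ (f x)
  extend-inject₁ f x rewrite view-inject₁ x = refl

  extend-injective : {f : Fin N → Fin N} → (∀ {x y} → f x ≡ f y → x ≡ y) →
                     ∀ {X Y} → extend f X ≡ extend f Y → X ≡ Y
  extend-injective inj {X} {Y} e with view X | view Y
  ... | ‵fromℕ          | ‵fromℕ          = refl
  ... | ‵fromℕ          | ‵inj₁ _         = contradiction e fromℕ≢inject₁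
  ... | ‵inj₁ _         | ‵fromℕ          = contradiction (sym e) fromℕ≢inject₁
  ... | ‵inj₁ _         | ‵inj₁ _         = cong inject₁ (inj (inject₁-injective e))

  extend≡fromℕ⇒≡fromℕ : (f : Fin N → Fin N) {X : Fin (suc N)} → extend f X ≡ fromℕ N → X ≡ fromℕ N
  extend≡fromℕ⇒≡fromℕ f {X} e with view X
  ... | ‵fromℕ  = refl
  ... | ‵inj₁ _ = contradiction (sym e) fromℕ≢inject₁

  -- insert σ p = σ̂ ∘ (p N), where σ̂ extends σ by the fixed point N: for p = fromℕ N the new
  -- point is a fixed point, for p = inject₁ a it is placed right after a in the cycle of a.
  insert : Table N → Fin (suc N) → Table (suc N)
  insert σ p = tabulate (extend (lookup σ) ∘ transpose p (fromℕ N))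

  module _ (σ : Table N) (p : Fin (suc N)) where

    lookup-insert : ∀ X → lookup (insert σ p) X ≡ extend (lookup σ) (transpose p (fromℕ N) X)
    lookup-insert = Vec.lookup∘tabulate _

    insert-transpose : ∀ X → lookup (insert σ p) (transpose p (fromℕ N) X) ≡ extend (lookup σ) X
    insert-transpose X =
      trans (lookup-insert (transpose p (fromℕ N) X)) (cong (extend (lookup σ)) (transpose-involutive p (fromℕ N) X))

    insert-fromℕ : lookup (insert σ p) (fromℕ N) ≡ extend (lookup σ) p
    insert-fromℕ = trans (lookup-insert (fromℕ N)) (cong (extend (lookup σ)) (transpose-matchʳ p (fromℕ N)))

    insert-slot : lookup (insert σ p) p ≡ fromℕ N
    insert-slot = trans (lookup-insert p) (trans (cong (extend (lookup σ)) (transpose-matchˡ p (fromℕ N))) (extend-fromℕ _))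

    insert-inject₁ : ∀ x → inject₁ x ≢ p → lookup (insert σ p) (inject₁ x) ≡ inject₁ (lookup σ x)
    insert-inject₁ x x≢p = trans (lookup-insert (inject₁ x))
      (trans (cong (extend (lookup σ)) (transpose-other x≢p (fromℕ≢inject₁ ∘ sym))) (extend-inject₁ _ x))

    insert-isPerm : IsPerm σ → IsPerm (insert σ p)
    insert-isPerm σ! {X} {Y} e = transpose-injective p (fromℕ N)
      (extend-injective σ! (trans (sym (lookup-insert X)) (trans e (lookup-insert Y))))

    isPerm-insert⁻ : IsPerm (insert σ p) → IsPerm σ
    isPerm-insert⁻ σ′! {x} {y} e = inject₁-injective (transpose-injective p (fromℕ N) (σ′! (begin
      lookup (insert σ p) (transpose p (fromℕ N) (inject₁ x)) ≡⟨ insert-transpose (inject₁ x) ⟩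
      extend (lookup σ) (inject₁ x)                           ≡⟨ extend-inject₁ _ x ⟩
      inject₁ (lookup σ x)                                    ≡⟨ cong inject₁ e ⟩
      inject₁ (lookup σ y)                                    ≡⟨ extend-inject₁ _ y ⟨
      extend (lookup σ) (inject₁ y)                           ≡⟨ insert-transpose (inject₁ y) ⟨
      lookup (insert σ p) (transpose p (fromℕ N) (inject₁ y)) ∎)))

insert-injective : ∀ {N} {σ τ : Table N} {p q} → insert σ p ≡ insert τ q → σ ≡ τ × p ≡ q
insert-injective {N} {σ} {τ} {p} {q} e = lookup-ext values , p≡q
  where
  p≡q : p ≡ q
  p≡q = begin
    p                                               ≡⟨ transpose-involutive q (fromℕ N) p ⟨
    transpose q (fromℕ N) (transpose q (fromℕ N) p) ≡⟨ cong (transpose q (fromℕ N)) slot ⟩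
    transpose q (fromℕ N) (fromℕ N)                 ≡⟨ transpose-matchʳ q (fromℕ N) ⟩
    q                                               ∎
    where
    slot : transpose q (fromℕ N) p ≡ fromℕ N
    slot = extend≡fromℕ⇒≡fromℕ (lookup τ) (begin
      extend (lookup τ) (transpose q (fromℕ N) p) ≡⟨ lookup-insert τ q p ⟨
      lookup (insert τ q) p                       ≡⟨ cong (λ ρ → lookup ρ p) e ⟨
      lookup (insert σ p) p                       ≡⟨ insert-slot σ p ⟩
      fromℕ N                                     ∎)
  values : ∀ x → lookup σ x ≡ lookup τ x
  values x = inject₁-injective (begin
    inject₁ (lookup σ x)                             ≡⟨ extend-inject₁ _ x ⟨
    extend (lookup σ) (inject₁ x)                    ≡⟨ insert-transpose σ p (inject₁ x) ⟨
    lookup (insert σ p) (transpose p (fromℕ N) (inject₁ x)) ≡⟨ cong (λ ρ → lookup ρ (transpose p (fromℕ N) (inject₁ x))) e ⟩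
    lookup (insert τ q) (transpose p (fromℕ N) (inject₁ x))
      ≡⟨ cong (λ s → lookup (insert τ q) (transpose s (fromℕ N) (inject₁ x))) p≡q ⟩
    lookup (insert τ q) (transpose q (fromℕ N) (inject₁ x)) ≡⟨ insert-transpose τ q (inject₁ x) ⟩
    extend (lookup τ) (inject₁ x)                    ≡⟨ extend-inject₁ _ x ⟩
    inject₁ (lookup τ x)                             ∎)

≢fromℕ⇒≢toℕ : ∀ {N} {X : Fin (suc N)} → X ≢ fromℕ N → N ≢ toℕ X
≢fromℕ⇒≢toℕ {N} X≢N N≡X = X≢N (Fin.toℕ-injective (trans (sym N≡X) (sym (toℕ-fromℕ N))))

preimage-fromℕ : ∀ {N} (σ : Table (suc N)) → IsPerm σ → ∃ λ p → lookup σ p ≡ fromℕ N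
preimage-fromℕ {N} σ σ! with Fin.any? (λ X → lookup σ X ≟ fromℕ N)
... | yes hit = hit
... | no miss with Fin.pigeonhole (n<1+n N) (λ X → lower₁ (lookup σ X) (≢fromℕ⇒≢toℕ (miss ∘ (X ,_))))
...   | i , j , i<j , collide = contradiction (cong toℕ (σ! (Fin.lower₁-injective collide))) (<⇒≢ i<j)

insert-surjective : ∀ {N} (σ : Table (suc N)) → IsPerm σ → ∃₂ λ τ p → σ ≡ insert τ p
insert-surjective {N} σ σ! with preimage-fromℕ σ σ!
... | p , σp≡N = τ , p , lookup-ext (λ X → sym (begin
      lookup (insert τ p) X           ≡⟨ lookup-insert τ p X ⟩
      extend (lookup τ) (t X)         ≡⟨ extend-τ (t X) ⟩
      lookup σ (t (t X))              ≡⟨ cong (lookup σ) (transpose-involutive p (fromℕ N) X) ⟩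
      lookup σ X                      ∎))
  where
  t = transpose p (fromℕ N)
  ρ : Fin (suc N) → Fin (suc N)
  ρ = lookup σ ∘ t
  ρ-fromℕ : ρ (fromℕ N) ≡ fromℕ N
  ρ-fromℕ = trans (cong (lookup σ) (transpose-matchʳ p (fromℕ N))) σp≡N
  ρ-inject₁ : ∀ x → ρ (inject₁ x) ≢ fromℕ N
  ρ-inject₁ x e = fromℕ≢inject₁ {i = x} (sym (transpose-injective p (fromℕ N) (σ! (trans e (sym ρ-fromℕ)))))
  τ : Table N
  τ = tabulate (λ x → lower₁ (ρ (inject₁ x)) (≢fromℕ⇒≢toℕ (ρ-inject₁ x)))
  extend-τ : ∀ Y → extend (lookup τ) Y ≡ ρ Y
  extend-τ Y with view Y
  ... | ‵fromℕ          = sym ρ-fromℕ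
  ... | ‵inj₁ {i = y} _ = trans (cong inject₁ (Vec.lookup∘tabulate _ y)) (inject₁-lower₁ _ _)

sum-cartesianProductWith : ∀ {A B C : Set} (f : C → ℕ) (g : A → B → C) xs ys →
  sum (map f (cartesianProductWith g xs ys)) ≡ sum (map (λ x → sum (map (f ∘ g x) ys)) xs)
sum-cartesianProductWith f g []       ys = refl
sum-cartesianProductWith f g (x ∷ xs) ys = begin
  sum (map f (map (g x) ys ++ cartesianProductWith g xs ys))
    ≡⟨ cong sum (List.map-++ f (map (g x) ys) _) ⟩
  sum (map f (map (g x) ys) ++ map f (cartesianProductWith g xs ys))
    ≡⟨ sum-++ (map f (map (g x) ys)) _ ⟩
  sum (map f (map (g x) ys)) + sum (map f (cartesianProductWith g xs ys))
    ≡⟨ cong₂ _+_ (cong sum (sym (List.map-∘ ys))) (sum-cartesianProductWith f g xs ys) ⟩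
  sum (map (f ∘ g x) ys) + sum (map (λ x → sum (map (f ∘ g x) ys)) xs) ∎

∈-insertions : ∀ {N} {σ : Table (suc N)} → IsPerm σ → σ ∈ cartesianProductWith insert (perms N) (allFin (suc N))
∈-insertions {N} {σ} σ! with insert-surjective σ σ!
... | τ , p , σ≡τ⁺ = subst (_∈ cartesianProductWith insert (perms N) (allFin (suc N))) (sym σ≡τ⁺)
    (∈-cartesianProductWith⁺ insert (from (∈-perms {σ = τ}) (isPerm-insert⁻ τ p (subst IsPerm σ≡τ⁺ σ!))) (∈-allFin p))

sum-perms-suc : ∀ N (f : Table (suc N) → ℕ) →
  sum (map f (perms (suc N))) ≡ sum (map (λ σ → ∑[ p < suc N ] f (insert σ p)) (perms N))
sum-perms-suc N f = begin
  sum (map f (perms (suc N)))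
    ≡⟨ sum-map-unique f (perms-unique (suc N)) insertions-unique (mk⇔ (∈-insertions ∘ to ∈-perms) compose) ⟩
  sum (map f insertions)
    ≡⟨ sum-cartesianProductWith f insert (perms N) (allFin (suc N)) ⟩
  sum (map (λ σ → sum (map (f ∘ insert σ) (allFin (suc N)))) (perms N))
    ≡⟨ sum-map-cong (perms N) (λ {σ} _ → sum-map-allFin (f ∘ insert σ)) ⟩
  sum (map (λ σ → ∑[ p < suc N ] f (insert σ p)) (perms N)) ∎
  where
  insertions = cartesianProductWith insert (perms N) (allFin (suc N))
  insertions-unique : Unique insertions
  insertions-unique = Unique.cartesianProductWith⁺ insert insert-injective (perms-unique N) (Unique.allFin⁺ (suc N))
  compose : ∀ {σ} → σ ∈ insertions → σ ∈ perms (suc N)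
  compose σ∈ with ∈-cartesianProductWith⁻ insert (perms N) (allFin (suc N)) σ∈
  ... | τ , p , τ∈ , _ , refl = from ∈-perms (insert-isPerm τ p (to ∈-perms τ∈))

pairCount : ∀ {M} → (ℕ → ℕ → Bool) → Table M → ℕ
pairCount {M} φ σ = countFin M (λ x → φ (toℕ x) (toℕ (lookup σ x)))

module _ {N : ℕ} (φ : ℕ → ℕ → Bool) (σ : Table N) where

  private
    term : ∀ {M} → Table M → Fin M → ℕ
    term τ x = 𝟙 (φ (toℕ x) (toℕ (lookup τ x)))

  pairCount-insert : ∀ p → pairCount φ (insert σ p) ≡
    ∑[ x < N ] term (insert σ p) (inject₁ x) + 𝟙 (φ N (toℕ (extend (lookup σ) p)))
  pairCount-insert p = begin
    pairCount φ (insert σ p)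
      ≡⟨ countFin-suc (λ X → φ (toℕ X) (toℕ (lookup (insert σ p) X))) ⟩
    ∑[ x < N ] term (insert σ p) (inject₁ x) + term (insert σ p) (fromℕ N)
      ≡⟨ cong (∑[ x < N ] term (insert σ p) (inject₁ x) +_)
              (cong 𝟙 (cong₂ φ (toℕ-fromℕ N) (cong toℕ (insert-fromℕ σ p)))) ⟩
    ∑[ x < N ] term (insert σ p) (inject₁ x) + 𝟙 (φ N (toℕ (extend (lookup σ) p))) ∎

  pairCount-insert-fixed : pairCount φ (insert σ (fromℕ N)) ≡ pairCount φ σ + 𝟙 (φ N N)
  pairCount-insert-fixed = begin
    pairCount φ (insert σ (fromℕ N))   ≡⟨ pairCount-insert (fromℕ N) ⟩
    ∑[ x < N ] term (insert σ (fromℕ N)) (inject₁ x) + 𝟙 (φ N (toℕ (extend (lookup σ) (fromℕ N))))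
      ≡⟨ cong₂ _+_ (sum-cong-≗ old) (cong (𝟙 ∘ φ N) (trans (cong toℕ (extend-fromℕ _)) (toℕ-fromℕ N))) ⟩
    ∑[ x < N ] term σ x + 𝟙 (φ N N)  ≡⟨ cong (_+ 𝟙 (φ N N)) (sum-map-allFin (term σ)) ⟨
    pairCount φ σ + 𝟙 (φ N N)        ∎
    where
    old : ∀ x → term (insert σ (fromℕ N)) (inject₁ x) ≡ term σ x
    old x = cong 𝟙 (cong₂ φ (toℕ-inject₁ x)
      (trans (cong toℕ (insert-inject₁ σ (fromℕ N) x (Fin.fromℕ≢inject₁ ∘ sym))) (toℕ-inject₁ _)))

  pairCount-insert-slot : ∀ a → pairCount φ (insert σ (inject₁ a)) + 𝟙 (φ (toℕ a) (toℕ (lookup σ a))) ≡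
                                   pairCount φ σ + 𝟙 (φ (toℕ a) N) + 𝟙 (φ N (toℕ (lookup σ a)))
  pairCount-insert-slot a = begin
    pairCount φ (insert σ (inject₁ a)) + term σ a  ≡⟨ cong (_+ term σ a) (pairCount-insert (inject₁ a)) ⟩
    ∑[ x < N ] new x + last + term σ a             ≡⟨ +-assoc _ last (term σ a) ⟩
    ∑[ x < N ] new x + (last + term σ a)           ≡⟨ cong (∑[ x < N ] new x +_) (+-comm last (term σ a)) ⟩
    ∑[ x < N ] new x + (term σ a + last)           ≡⟨ +-assoc _ (term σ a) last ⟨
    ∑[ x < N ] new x + term σ a + last             ≡⟨ cong (_+ last) (∑-except new (term σ) a old) ⟩
    ∑[ x < N ] term σ x + new a + last             ≡⟨ cong₂ (λ s t → s + t + last) (sym (sum-map-allFin (term σ))) slot ⟩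
    pairCount φ σ + 𝟙 (φ (toℕ a) N) + last         ≡⟨ cong (λ v → pairCount φ σ + 𝟙 (φ (toℕ a) N) + 𝟙 (φ N v))
                                                           (trans (cong toℕ (extend-inject₁ _ a)) (toℕ-inject₁ _)) ⟩
    pairCount φ σ + 𝟙 (φ (toℕ a) N) + 𝟙 (φ N (toℕ (lookup σ a))) ∎
    where
    new : Fin N → ℕ
    new x = term (insert σ (inject₁ a)) (inject₁ x)
    last = 𝟙 (φ N (toℕ (extend (lookup σ) (inject₁ a))))
    old : ∀ x → x ≢ a → new x ≡ term σ x
    old x x≢a = cong 𝟙 (cong₂ φ (toℕ-inject₁ x)
      (trans (cong toℕ (insert-inject₁ σ (inject₁ a) x (x≢a ∘ Fin.inject₁-injective))) (toℕ-inject₁ _)))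
    slot : new a ≡ 𝟙 (φ (toℕ a) N)
    slot = cong 𝟙 (cong₂ φ (toℕ-inject₁ a) (trans (cong toℕ (insert-slot σ (inject₁ a))) (toℕ-fromℕ N)))

InsideR : ℕ → (ℕ → ℕ → Bool) → Set
InsideR r ψ = ∀ {i v} → T (ψ i v) → i < r × v < r

fixedOutside : ℕ → ℕ → ℕ → Bool
fixedOutside r i v = not (i <ᵇ r) ∧ (v ≡ᵇ i)

module _ {r N : ℕ} (r≤N : r ≤ N) (σ : Table N) where

  module _ {ψ : ℕ → ℕ → Bool} (ψ⊆R : InsideR r ψ) where

    private
      ψ-out : ∀ i → 𝟙 (ψ N i) ≡ 0 × 𝟙 (ψ i N) ≡ 0
      ψ-out i = 𝟙-¬T (λ t → <⇒≱ (proj₁ (ψ⊆R t)) r≤N) , 𝟙-¬T (λ t → <⇒≱ (proj₂ (ψ⊆R t)) r≤N)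

    insideR-insert-fixed : pairCount ψ (insert σ (fromℕ N)) ≡ pairCount ψ σ
    insideR-insert-fixed = trans (pairCount-insert-fixed ψ σ) (trans (cong (pairCount ψ σ +_) (proj₁ (ψ-out N))) (+-identityʳ _))

    insideR-insert-slot : ∀ a → pairCount ψ (insert σ (inject₁ a)) + 𝟙 (ψ (toℕ a) (toℕ (lookup σ a))) ≡ pairCount ψ σ
    insideR-insert-slot a = begin
      pairCount ψ (insert σ (inject₁ a)) + 𝟙 (ψ (toℕ a) (toℕ (lookup σ a)))
        ≡⟨ pairCount-insert-slot ψ σ a ⟩
      pairCount ψ σ + 𝟙 (ψ (toℕ a) N) + 𝟙 (ψ N (toℕ (lookup σ a)))
        ≡⟨ cong₂ (λ s t → pairCount ψ σ + s + t) (proj₂ (ψ-out (toℕ a))) (proj₁ (ψ-out _)) ⟩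
      pairCount ψ σ + 0 + 0
        ≡⟨ trans (+-identityʳ _) (+-identityʳ _) ⟩
      pairCount ψ σ ∎

  fixedOutR-insert-fixed : fixedOutR r (insert σ (fromℕ N)) ≡ suc (fixedOutR r σ)
  fixedOutR-insert-fixed = begin
    fixedOutR r (insert σ (fromℕ N))                       ≡⟨ pairCount-insert-fixed (fixedOutside r) σ ⟩
    fixedOutR r σ + 𝟙 (not (N <ᵇ r) ∧ (N ≡ᵇ N))
      ≡⟨ cong₂ (λ b c → fixedOutR r σ + 𝟙 (not b ∧ c)) (<ᵇ-false r≤N) (Equivalence.to T-≡ (≡⇒≡ᵇ N N refl)) ⟩
    fixedOutR r σ + 1                                      ≡⟨ +-comm _ 1 ⟩
    suc (fixedOutR r σ)                                    ∎

  fixedOutR-insert-slot : ∀ a →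
    fixedOutR r (insert σ (inject₁ a)) + 𝟙 (fixedOutside r (toℕ a) (toℕ (lookup σ a))) ≡ fixedOutR r σ
  fixedOutR-insert-slot a = begin
    fixedOutR r (insert σ (inject₁ a)) + 𝟙 (fixedOutside r (toℕ a) (toℕ (lookup σ a)))
      ≡⟨ pairCount-insert-slot (fixedOutside r) σ a ⟩
    fixedOutR r σ + 𝟙 (fixedOutside r (toℕ a) N) + 𝟙 (fixedOutside r N (toℕ (lookup σ a)))
      ≡⟨ cong₂ (λ s t → fixedOutR r σ + s + t) (𝟙-¬T (<⇒≢ (toℕ<n a) ∘ sym ∘ fixed)) (𝟙-¬T (<⇒≢ (toℕ<n (lookup σ a)) ∘ fixed)) ⟩
    fixedOutR r σ + 0 + 0
      ≡⟨ trans (+-identityʳ _) (+-identityʳ _) ⟩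
    fixedOutR r σ ∎
    where
    fixed : ∀ {i v} → T (fixedOutside r i v) → v ≡ i
    fixed {i} {v} t = ≡ᵇ⇒≡ v i (proj₂ (Equivalence.to T-∧ t))

SameCycle : ∀ {N} → Table N → Fin N → Fin N → Set
SameCycle σ x y = ∃[ j ] iter σ j x ≡ y

module _ {N : ℕ} (σ : Table N) where

  iter-+ : ∀ i j x → iter σ (i + j) x ≡ iter σ i (iter σ j x)
  iter-+ zero    j x = refl
  iter-+ (suc i) j x = cong (lookup σ) (iter-+ i j x)

  iter-* : ∀ {d x} → iter σ d x ≡ x → ∀ q → iter σ (q * d) x ≡ x
  iter-* {d} {x} period zero    = refl
  iter-* {d} {x} period (suc q) = trans (iter-+ d (q * d) x) (trans (cong (iter σ d) (iter-* period q)) period)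

  module _ (σ! : IsPerm σ) where

    iter-injective : ∀ j {x y} → iter σ j x ≡ iter σ j y → x ≡ y
    iter-injective zero    e = e
    iter-injective (suc j) e = iter-injective j (σ! e)

    period : ∀ x → ∃[ d ] suc d ≤ N × iter σ (suc d) x ≡ x
    period x with Fin.pigeonhole (n<1+n N) (λ k → iter σ (toℕ k) x)
    ... | i , j , i<j , collide = d , m+n≤o⇒n≤o (toℕ i) (s≤s⁻¹ (subst (_< suc N) j≡i+[1+d] (toℕ<n j))) , returns
      where
      d = toℕ j ∸ suc (toℕ i)
      j≡i+[1+d] : toℕ j ≡ toℕ i + suc d
      j≡i+[1+d] = trans (sym (m+[n∸m]≡n i<j)) (sym (+-suc (toℕ i) d))
      returns : iter σ (suc d) x ≡ x
      returns = sym (iter-injective (toℕ i) (begin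
        iter σ (toℕ i) x                   ≡⟨ collide ⟩
        iter σ (toℕ j) x                   ≡⟨ cong (λ k → iter σ k x) j≡i+[1+d] ⟩
        iter σ (toℕ i + suc d) x           ≡⟨ iter-+ (toℕ i) (suc d) x ⟩
        iter σ (toℕ i) (iter σ (suc d) x)  ∎))
        where open ≡-Reasoning

    iter-below : ∀ j x → ∃[ j′ ] j′ < N × iter σ j′ x ≡ iter σ j x
    iter-below j x with period x
    ... | d , d<N , returns = j % suc d , <-≤-trans (m%n<n j (suc d)) d<N , sym (begin
      iter σ j x                                       ≡⟨ cong (λ k → iter σ k x) (m≡m%n+[m/n]*n j (suc d)) ⟩
      iter σ (j % suc d + j / suc d * suc d) x         ≡⟨ iter-+ (j % suc d) _ x ⟩
      iter σ (j % suc d) (iter σ (j / suc d * suc d) x) ≡⟨ cong (iter σ (j % suc d)) (iter-* returns (j / suc d)) ⟩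
      iter σ (j % suc d) x                             ∎)
      where open ≡-Reasoning

    sameCycle-reflects : ∀ {x y} → T (sameCycle σ x y) ⇔ SameCycle σ x y
    sameCycle-reflects {x} {y} = mk⇔
      (λ t → let j , e = satisfied (any⁻ _ (upTo N) t) in j , to ≟ᶠ-reflects e)
      (λ (j , e) → let j′ , j′<N , e′ = iter-below j x in
        any⁺ _ (lose (∈-upTo⁺ j′<N) (from ≟ᶠ-reflects (trans e′ e))))

module _ {N : ℕ} (σ : Table N) (p : Fin (suc N)) where

  private
    σ′ = insert σ p

    step-inject₁ : ∀ y → (inject₁ y ≡ p × lookup σ′ (inject₁ y) ≡ fromℕ N)
                       ⊎ (inject₁ y ≢ p × lookup σ′ (inject₁ y) ≡ inject₁ (lookup σ y))
    step-inject₁ y with inject₁ y ≟ p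
    ... | yes y≡p = inj₁ (y≡p , trans (cong (lookup σ′) y≡p) (insert-slot σ p))
    ... | no  y≢p = inj₂ (y≢p , insert-inject₁ σ p y y≢p)

    step-fromℕ : ∀ {y} → inject₁ y ≡ p → lookup σ′ (fromℕ N) ≡ inject₁ (lookup σ y)
    step-fromℕ {y} y≡p = trans (insert-fromℕ σ p) (trans (cong (extend (lookup σ)) (sym y≡p)) (extend-inject₁ (lookup σ) y))

    forward : ∀ x j → (∃[ j′ ] iter σ′ j (inject₁ x) ≡ inject₁ (iter σ j′ x))
                    ⊎ (∃[ j′ ] inject₁ (iter σ j′ x) ≡ p × iter σ′ j (inject₁ x) ≡ fromℕ N)
    forward x zero = inj₁ (0 , refl)
    forward x (suc j) with forward x j
    ... | inj₂ (j′ , hit , e) = inj₁ (suc j′ , trans (cong (lookup σ′) e) (step-fromℕ hit))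
    ... | inj₁ (j′ , e) with step-inject₁ (iter σ j′ x)
    ...   | inj₁ (hit , s) = inj₂ (j′ , hit , trans (cong (lookup σ′) e) s)
    ...   | inj₂ (_ , s)   = inj₁ (suc j′ , trans (cong (lookup σ′) e) s)

    backward : ∀ x j′ → ∃[ j ] iter σ′ j (inject₁ x) ≡ inject₁ (iter σ j′ x)
    backward x zero = 0 , refl
    backward x (suc j′) with backward x j′
    ... | j , e with step-inject₁ (iter σ j′ x)
    ...   | inj₂ (_ , s)   = suc j , trans (cong (lookup σ′) e) s
    ...   | inj₁ (hit , s) = suc (suc j) , trans (cong (lookup σ′) (trans (cong (lookup σ′) e) s)) (step-fromℕ hit)

  sameCycle-insert : ∀ {x y} → SameCycle (insert σ p) (inject₁ x) (inject₁ y) ⇔ SameCycle σ x y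
  sameCycle-insert {x} {y} = mk⇔ restrict (λ (j′ , e) → let j , e′ = backward x j′ in j , trans e′ (cong inject₁ e))
    where
    restrict : SameCycle σ′ (inject₁ x) (inject₁ y) → SameCycle σ x y
    restrict (j , e) with forward x j
    ... | inj₁ (j′ , e′)    = j′ , inject₁-injective (trans (sym e′) e)
    ... | inj₂ (_ , _ , e′) = contradiction (trans (sym e′) e) fromℕ≢inject₁

  sameCycle-slot : SameCycle (insert σ p) p (fromℕ N)
  sameCycle-slot = 1 , insert-slot σ p

  sameCycle-insert-fixed : p ≡ fromℕ N → ∀ x → ¬ SameCycle (insert σ p) (inject₁ x) (fromℕ N)
  sameCycle-insert-fixed p≡N x (j , e) with forward x j
  ... | inj₁ (_ , e′)       = fromℕ≢inject₁ (trans (sym e) e′)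
  ... | inj₂ (_ , hit , _)  = fromℕ≢inject₁ (trans (sym p≡N) (sym hit))

smallerMate : ∀ {M} → Table M → Fin M → Fin M → Bool
smallerMate σ x y = (toℕ y <ᵇ toℕ x) ∧ sameCycle σ y x

module _ {M} (σ : Table M) {x y : Fin M} where

  smallerMate⁻ : T (smallerMate σ x y) → toℕ y < toℕ x × T (sameCycle σ y x)
  smallerMate⁻ t = let y<x , y∼x = to (T-∧ {toℕ y <ᵇ toℕ x}) t in <ᵇ⇒< _ _ y<x , y∼x

  smallerMate⁺ : toℕ y < toℕ x → T (sameCycle σ y x) → T (smallerMate σ x y)
  smallerMate⁺ y<x y∼x = from T-∧ (<⇒<ᵇ y<x , y∼x)

isCycleMin : ∀ {M} → Table M → Fin M → Bool
isCycleMin {M} σ x = not (anyFin M (smallerMate σ x))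

inject₁<fromℕ : ∀ {N} (x : Fin N) → toℕ (inject₁ x) < toℕ (fromℕ N)
inject₁<fromℕ {N} x = subst₂ _<_ (sym (toℕ-inject₁ x)) (sym (toℕ-fromℕ N)) (toℕ<n x)

module _ {N : ℕ} (σ : Table N) (σ! : IsPerm σ) (p : Fin (suc N)) where

  private
    σ′ = insert σ p
    σ′! = insert-isPerm σ p σ!

  sameCycleᵇ-insert : ∀ x y → sameCycle (insert σ p) (inject₁ x) (inject₁ y) ≡ sameCycle σ x y
  sameCycleᵇ-insert x y = T⇔T⇒≡ (⇔.trans (sameCycle-reflects σ′ σ′!)
    (⇔.trans (sameCycle-insert σ p) (⇔.sym (sameCycle-reflects σ σ!))))

  isCycleMin-inject₁ : ∀ x → isCycleMin (insert σ p) (inject₁ x) ≡ isCycleMin σ x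
  isCycleMin-inject₁ x = cong not (T⇔T⇒≡ (mk⇔ restrict extend′))
    where
    restrict : T (anyFin (suc N) (smallerMate σ′ (inject₁ x))) → T (anyFin N (smallerMate σ x))
    restrict t with to (T-anyFin _) t
    ... | Y , hit with smallerMate⁻ σ′ hit
    ...   | Y<x , Y∼x with view Y
    ...     | ‵fromℕ          = contradiction Y<x (<⇒≯ (inject₁<fromℕ x))
    ...     | ‵inj₁ {i = y} _ = from (T-anyFin _) (y , smallerMate⁺ σ
                (subst₂ _<_ (toℕ-inject₁ y) (toℕ-inject₁ x) Y<x) (subst T (sameCycleᵇ-insert y x) Y∼x))
    extend′ : T (anyFin N (smallerMate σ x)) → T (anyFin (suc N) (smallerMate σ′ (inject₁ x)))
    extend′ t with to (T-anyFin _) t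
    ... | y , hit with smallerMate⁻ σ hit
    ...   | y<x , y∼x = from (T-anyFin _) (inject₁ y , smallerMate⁺ σ′
            (subst₂ _<_ (sym (toℕ-inject₁ y)) (sym (toℕ-inject₁ x)) y<x) (subst T (sym (sameCycleᵇ-insert y x)) y∼x))

module _ {N : ℕ} (σ : Table N) (σ! : IsPerm σ) where

  isCycleMin-fixed : isCycleMin (insert σ (fromℕ N)) (fromℕ N) ≡ true
  isCycleMin-fixed = cong not (¬T⇒≡false no-mate)
    where
    σ′ = insert σ (fromℕ N)
    no-mate : ¬ T (anyFin (suc N) (smallerMate σ′ (fromℕ N)))
    no-mate t with to (T-anyFin _) t
    ... | Y , hit with smallerMate⁻ σ′ hit
    ...   | Y<N , Y∼N with view Y
    ...     | ‵fromℕ          = <-irrefl refl Y<N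
    ...     | ‵inj₁ {i = y} _ = sameCycle-insert-fixed σ (fromℕ N) refl y
                                  (to (sameCycle-reflects σ′ (insert-isPerm σ (fromℕ N) σ!)) Y∼N)

  isCycleMin-slot : ∀ a → isCycleMin (insert σ (inject₁ a)) (fromℕ N) ≡ false
  isCycleMin-slot a = cong not (to T-≡ (from (T-anyFin _) (inject₁ a , smallerMate⁺ σ′ (inject₁<fromℕ a)
    (from (sameCycle-reflects σ′ (insert-isPerm σ (inject₁ a) σ!)) (sameCycle-slot σ (inject₁ a))))))
    where σ′ = insert σ (inject₁ a)

  private
    unchanged : ∀ p c x → 𝟙 ((toℕ (inject₁ x) <ᵇ c) ∧ isCycleMin (insert σ p) (inject₁ x)) ≡
                          𝟙 ((toℕ x <ᵇ c) ∧ isCycleMin σ x)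
    unchanged p c x = cong 𝟙 (cong₂ _∧_ (cong (_<ᵇ c) (toℕ-inject₁ x)) (isCycleMin-inject₁ σ σ! p x))

    cyclesMeeting-insert : ∀ p c → cyclesMeeting c (insert σ p) ≡
      cyclesMeeting c σ + 𝟙 ((N <ᵇ c) ∧ isCycleMin (insert σ p) (fromℕ N))
    cyclesMeeting-insert p c = trans (countFin-suc (λ x → (toℕ x <ᵇ c) ∧ isCycleMin (insert σ p) x)) (cong₂ _+_
      (trans (sum-cong-≗ (unchanged p c)) (sym (sum-map-allFin (λ x → 𝟙 ((toℕ x <ᵇ c) ∧ isCycleMin σ x)))))
      (cong (λ i → 𝟙 ((i <ᵇ c) ∧ isCycleMin (insert σ p) (fromℕ N))) (toℕ-fromℕ N)))

  cyclesMeeting-insert-fixed : ∀ c → cyclesMeeting c (insert σ (fromℕ N)) ≡ cyclesMeeting c σ + 𝟙 (N <ᵇ c)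
  cyclesMeeting-insert-fixed c = trans (cyclesMeeting-insert (fromℕ N) c)
    (trans (cong (λ b → cyclesMeeting c σ + 𝟙 ((N <ᵇ c) ∧ b)) isCycleMin-fixed)
           (cong (λ b → cyclesMeeting c σ + 𝟙 b) (∧-identityʳ _)))

  cyclesMeeting-insert-slot : ∀ c a → cyclesMeeting c (insert σ (inject₁ a)) ≡ cyclesMeeting c σ
  cyclesMeeting-insert-slot c a = trans (cyclesMeeting-insert (inject₁ a) c)
    (trans (cong (λ b → cyclesMeeting c σ + 𝟙 ((N <ᵇ c) ∧ b)) (isCycleMin-slot a))
    (trans (cong (λ b → cyclesMeeting c σ + 𝟙 b) (∧-zeroʳ _)) (+-identityʳ _)))

cyclesMeeting-≥ : ∀ {M} c (σ : Table M) → M ≤ c → cyclesMeeting c σ ≡ numCycles σ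
cyclesMeeting-≥ c σ M≤c = countFin-cong λ x →
  cong (_∧ isCycleMin σ x) (trans (<ᵇ-true (<-≤-trans (toℕ<n x) M≤c)) (sym (<ᵇ-true (toℕ<n x))))

separatedPair : ℕ → ℕ → ℕ → Bool → Bool
separatedPair r i j sameCyc = not ((i <ᵇ r) ∧ (j <ᵇ r) ∧ not (i ≡ᵇ j)) ∨ not sameCyc

separated : ∀ {M} → ℕ → Table M → Bool
separated {M} r σ = allFin? M (λ x → allFin? M (λ y → separatedPair r (toℕ x) (toℕ y) (sameCycle σ x y)))

module _ {r : ℕ} where

  separatedPair-outsideˡ : ∀ {i} j s → r ≤ i → separatedPair r i j s ≡ true
  separatedPair-outsideˡ j s r≤i rewrite <ᵇ-false r≤i = refl

  separatedPair-outsideʳ : ∀ i {j} s → r ≤ j → separatedPair r i j s ≡ true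
  separatedPair-outsideʳ i s r≤j rewrite <ᵇ-false r≤j | ∧-zeroʳ (i <ᵇ r) = refl

  separated-insert : ∀ {N} → r ≤ N → (σ : Table N) → IsPerm σ → ∀ p → separated r (insert σ p) ≡ separated r σ
  separated-insert {N} r≤N σ σ! p = T⇔T⇒≡ (mk⇔ restrict extend′)
    where
    σ′ = insert σ p
    pair : ∀ {M} → Table M → Fin M → Fin M → Bool
    pair τ x y = separatedPair r (toℕ x) (toℕ y) (sameCycle τ x y)
    old : ∀ x y → pair σ′ (inject₁ x) (inject₁ y) ≡ pair σ x y
    old x y = trans (cong₂ (λ i j → separatedPair r i j (sameCycle σ′ (inject₁ x) (inject₁ y))) (toℕ-inject₁ x) (toℕ-inject₁ y))
                    (cong (separatedPair r (toℕ x) (toℕ y)) (sameCycleᵇ-insert σ σ! p x y))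
    r≤N′ : r ≤ toℕ (fromℕ N)
    r≤N′ = subst (r ≤_) (sym (toℕ-fromℕ N)) r≤N
    restrict : T (separated r σ′) → T (separated r σ)
    restrict t = from (T-allFin? _) λ x → from (T-allFin? _) λ y →
      subst T (old x y) (to (T-allFin? _) (to (T-allFin? _) t (inject₁ x)) (inject₁ y))
    extend′ : T (separated r σ) → T (separated r σ′)
    extend′ t = from (T-allFin? _) λ X → from (T-allFin? _) λ Y → pairs X Y
      where
      pairs : ∀ X Y → T (pair σ′ X Y)
      pairs X Y with view X | view Y
      ... | ‵fromℕ | _      = from T-≡ (separatedPair-outsideˡ _ _ r≤N′)
      ... | ‵inj₁ _ | ‵fromℕ = from T-≡ (separatedPair-outsideʳ _ _ r≤N′)
      ... | ‵inj₁ {i = x} _ | ‵inj₁ {i = y} _ =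
        subst T (sym (old x y)) (to (T-allFin? _) (to (T-allFin? _) t x) y)

∑-update : ∀ {N} (f g : Fin N → ℕ) a k → (∀ x → x ≢ a → f x ≡ g x) → f a ≡ g a + k →
           ∑[ i < N ] f i ≡ ∑[ i < N ] g i + k
∑-update f g a k f≗g fa = +-cancelʳ-≡ (g a) _ _ (begin
  ∑[ i < _ ] f i + g a     ≡⟨ ∑-except f g a f≗g ⟩
  ∑[ i < _ ] g i + f a     ≡⟨ cong (∑[ i < _ ] g i +_) (trans fa (+-comm (g a) k)) ⟩
  ∑[ i < _ ] g i + (k + g a) ≡⟨ +-assoc _ k (g a) ⟨
  ∑[ i < _ ] g i + k + g a ∎)

row : ∀ {M} → (Fin M → ℕ) → Fin M → ℕ
row {M} v x = ∑[ y < M ] 𝟙 ((toℕ x <ᵇ toℕ y) ∧ (v y <ᵇ v x))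

inversions-∑ : ∀ {M} (σ : Table M) → inversions σ ≡ ∑[ x < M ] row (toℕ ∘ lookup σ) x
inversions-∑ {M} σ = trans (sum-map-allFin (λ x → countFin M (λ y → (toℕ x <ᵇ toℕ y) ∧ (v y <ᵇ v x))))
  (sum-cong-≗ (λ x → sum-map-allFin (λ y → 𝟙 ((toℕ x <ᵇ toℕ y) ∧ (v y <ᵇ v x)))))
  where v = toℕ ∘ lookup σ

-- g lists the values of σ and f those of insert σ (inject₁ a) at the old positions: the value
-- at a is raised to the new maximum N, while g a moves to the new last position.
module RaiseToMaximum {N : ℕ} (g f : Fin N → ℕ) (a : Fin N)
  (g-injective : ∀ {x y} → g x ≡ g y → x ≡ y) (g<N : ∀ x → g x < N)
  (f≗g : ∀ x → x ≢ a → f x ≡ g x) (fa≡N : f a ≡ N) where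

  below : Fin N → ℕ
  below x = 𝟙 ((toℕ x <ᵇ toℕ a) ∧ (g a <ᵇ g x))

  above : Fin N → ℕ
  above y = 𝟙 ((toℕ a <ᵇ toℕ y) ∧ (g a <ᵇ g y))

  E : ℕ
  E = ∑[ y < N ] above y

  row-off : ∀ x → x ≢ a → row f x + below x ≡ row g x
  row-off x x≢a = begin
    row f x + below x
      ≡⟨ ∑-except (λ y → 𝟙 ((toℕ x <ᵇ toℕ y) ∧ (f y <ᵇ f x))) (λ y → 𝟙 ((toℕ x <ᵇ toℕ y) ∧ (g y <ᵇ g x))) a same ⟩
    row g x + 𝟙 ((toℕ x <ᵇ toℕ a) ∧ (f a <ᵇ f x)) ≡⟨ cong (λ b → row g x + 𝟙 ((toℕ x <ᵇ toℕ a) ∧ b)) fa≮fx ⟩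
    row g x + 𝟙 ((toℕ x <ᵇ toℕ a) ∧ false) ≡⟨ cong (λ b → row g x + 𝟙 b) (∧-zeroʳ _) ⟩
    row g x + 0 ≡⟨ +-identityʳ _ ⟩
    row g x ∎
    where
    same : ∀ y → y ≢ a → 𝟙 ((toℕ x <ᵇ toℕ y) ∧ (f y <ᵇ f x)) ≡ 𝟙 ((toℕ x <ᵇ toℕ y) ∧ (g y <ᵇ g x))
    same y y≢a = cong (λ b → 𝟙 ((toℕ x <ᵇ toℕ y) ∧ b)) (cong₂ _<ᵇ_ (f≗g y y≢a) (f≗g x x≢a))
    fa≮fx : (f a <ᵇ f x) ≡ false
    fa≮fx = <ᵇ-false (subst₂ _≤_ (sym (f≗g x x≢a)) (sym fa≡N) (<⇒≤ (g<N x)))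

  row-at : row f a ≡ row g a + E
  row-at = trans (sum-cong-≗ split) (∑-distrib-+ (λ y → 𝟙 ((toℕ a <ᵇ toℕ y) ∧ (g y <ᵇ g a))) above)
    where
    split : ∀ y → 𝟙 ((toℕ a <ᵇ toℕ y) ∧ (f y <ᵇ f a)) ≡
                  𝟙 ((toℕ a <ᵇ toℕ y) ∧ (g y <ᵇ g a)) + above y
    split y with y ≟ a
    ... | yes refl rewrite <ᵇ-false (≤-refl {toℕ a}) = refl
    ... | no y≢a = begin
      𝟙 ((toℕ a <ᵇ toℕ y) ∧ (f y <ᵇ f a))
        ≡⟨ cong (λ b → 𝟙 ((toℕ a <ᵇ toℕ y) ∧ b)) (trans (cong₂ _<ᵇ_ (f≗g y y≢a) fa≡N) (<ᵇ-true (g<N y))) ⟩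
      𝟙 ((toℕ a <ᵇ toℕ y) ∧ true)         ≡⟨ cong 𝟙 (∧-identityʳ _) ⟩
      𝟙 (toℕ a <ᵇ toℕ y)                  ≡⟨ 𝟙-<ᵇ-split _ (y≢a ∘ g-injective) ⟨
      𝟙 ((toℕ a <ᵇ toℕ y) ∧ (g y <ᵇ g a)) + 𝟙 ((toℕ a <ᵇ toℕ y) ∧ (g a <ᵇ g y)) ∎

  above-split : ∀ x → 𝟙 (g a <ᵇ g x) ≡ below x + above x
  above-split x with x ≟ a
  ... | yes refl rewrite <ᵇ-false (≤-refl {g a}) | ∧-zeroʳ (toℕ a <ᵇ toℕ a) = refl
  ... | no x≢a = begin
    𝟙 (g a <ᵇ g x) ≡⟨ 𝟙-<ᵇ-split _ (x≢a ∘ Fin.toℕ-injective) ⟨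
    𝟙 ((g a <ᵇ g x) ∧ (toℕ x <ᵇ toℕ a)) + 𝟙 ((g a <ᵇ g x) ∧ (toℕ a <ᵇ toℕ x))
      ≡⟨ cong₂ _+_ (cong 𝟙 (∧-comm (g a <ᵇ g x) _)) (cong 𝟙 (∧-comm (g a <ᵇ g x) _)) ⟩
    below x + above x ∎

  inversions-raise : ∑[ x < N ] (row f x + 𝟙 (g a <ᵇ f x)) ≡ ∑[ x < N ] row g x + suc (E + E)
  inversions-raise = +-cancelʳ-≡ (∑[ x < N ] below x) _ _ (begin
    ∑[ x < N ] (row f x + 𝟙 (g a <ᵇ f x)) + ∑[ x < N ] below x
      ≡⟨ ∑-distrib-+ (λ x → row f x + 𝟙 (g a <ᵇ f x)) below ⟨
    ∑[ x < N ] (row f x + 𝟙 (g a <ᵇ f x) + below x)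
      ≡⟨ ∑-update (λ x → row f x + 𝟙 (g a <ᵇ f x) + below x) (λ x → row g x + 𝟙 (g a <ᵇ g x)) a (suc E) off at ⟩
    ∑[ x < N ] (row g x + 𝟙 (g a <ᵇ g x)) + suc E
      ≡⟨ cong (_+ suc E) (trans (∑-distrib-+ (row g) (λ x → 𝟙 (g a <ᵇ g x))) (cong (∑[ x < N ] row g x +_) (trans (sum-cong-≗ above-split) (∑-distrib-+ below above)))) ⟩
    ∑[ x < N ] row g x + (∑[ x < N ] below x + E) + suc E
      ≡⟨ rearrange (∑[ x < N ] row g x) (∑[ x < N ] below x) E ⟩
    ∑[ x < N ] row g x + suc (E + E) + ∑[ x < N ] below x ∎)
    where
    rearrange : ∀ i c e → i + (c + e) + suc e ≡ i + suc (e + e) + c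
    rearrange = solve-∀
    off : ∀ x → x ≢ a → row f x + 𝟙 (g a <ᵇ f x) + below x ≡ row g x + 𝟙 (g a <ᵇ g x)
    off x x≢a = begin
      row f x + 𝟙 (g a <ᵇ f x) + below x ≡⟨ cong (λ v → row f x + 𝟙 (g a <ᵇ v) + below x) (f≗g x x≢a) ⟩
      row f x + 𝟙 (g a <ᵇ g x) + below x ≡⟨ +-assoc (row f x) _ _ ⟩
      row f x + (𝟙 (g a <ᵇ g x) + below x) ≡⟨ cong (row f x +_) (+-comm _ (below x)) ⟩
      row f x + (below x + 𝟙 (g a <ᵇ g x)) ≡⟨ +-assoc (row f x) _ _ ⟨
      row f x + below x + 𝟙 (g a <ᵇ g x) ≡⟨ cong (_+ 𝟙 (g a <ᵇ g x)) (row-off x x≢a) ⟩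
      row g x + 𝟙 (g a <ᵇ g x) ∎
    at : row f a + 𝟙 (g a <ᵇ f a) + below a ≡ row g a + 𝟙 (g a <ᵇ g a) + suc E
    at rewrite row-at | fa≡N | <ᵇ-true (g<N a) | <ᵇ-false (≤-refl {g a}) | <ᵇ-false (≤-refl {toℕ a}) = arith (row g a) E
      where
      arith : ∀ r e → r + e + 1 + 0 ≡ r + 0 + suc e
      arith = solve-∀

row-cong : ∀ {M} {v v′ : Fin M → ℕ} → (∀ x → v x ≡ v′ x) → ∀ x → row v x ≡ row v′ x
row-cong v≗v′ x = sum-cong-≗ λ y → cong (λ b → 𝟙 ((toℕ x <ᵇ toℕ y) ∧ b)) (cong₂ _<ᵇ_ (v≗v′ y) (v≗v′ x))

module _ {N : ℕ} (σ : Table N) where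

  private
    old : Table (suc N) → Fin N → ℕ
    old τ x = toℕ (lookup τ (inject₁ x))

  inversions-insert : ∀ p → inversions (insert σ p) ≡
    ∑[ x < N ] (row (old (insert σ p)) x + 𝟙 (toℕ (extend (lookup σ) p) <ᵇ old (insert σ p) x))
  inversions-insert p = begin
    inversions σ′                                          ≡⟨ inversions-∑ σ′ ⟩
    ∑[ X < suc N ] row v X                                 ≡⟨ sum-init-last (row v) ⟩
    ∑[ x < N ] row v (inject₁ x) + row v (fromℕ N)          ≡⟨ cong₂ _+_ (sum-cong-≗ row-old) row-new ⟩
    ∑[ x < N ] (row (old σ′) x + 𝟙 (toℕ (extend (lookup σ) p) <ᵇ old σ′ x)) + 0 ≡⟨ +-identityʳ _ ⟩
    ∑[ x < N ] (row (old σ′) x + 𝟙 (toℕ (extend (lookup σ) p) <ᵇ old σ′ x)) ∎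
    where
    σ′ = insert σ p
    v = toℕ ∘ lookup σ′
    row-old : ∀ x → row v (inject₁ x) ≡ row (old σ′) x + 𝟙 (toℕ (extend (lookup σ) p) <ᵇ old σ′ x)
    row-old x = begin
      row v (inject₁ x)
        ≡⟨ sum-init-last (λ Y → 𝟙 ((toℕ (inject₁ x) <ᵇ toℕ Y) ∧ (v Y <ᵇ v (inject₁ x)))) ⟩
      ∑[ y < N ] 𝟙 ((toℕ (inject₁ x) <ᵇ toℕ (inject₁ y)) ∧ (old σ′ y <ᵇ old σ′ x))
        + 𝟙 ((toℕ (inject₁ x) <ᵇ toℕ (fromℕ N)) ∧ (v (fromℕ N) <ᵇ old σ′ x))
        ≡⟨ cong₂ _+_ (sum-cong-≗ λ y → cong (λ b → 𝟙 (b ∧ (old σ′ y <ᵇ old σ′ x))) (cong₂ _<ᵇ_ (toℕ-inject₁ x) (toℕ-inject₁ y)))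
                     (cong₂ (λ b u → 𝟙 (b ∧ (u <ᵇ old σ′ x))) (<ᵇ-true (inject₁<fromℕ x)) (cong toℕ (insert-fromℕ σ p))) ⟩
      row (old σ′) x + 𝟙 (toℕ (extend (lookup σ) p) <ᵇ old σ′ x) ∎
    row-new : row v (fromℕ N) ≡ 0
    row-new = trans (sum-cong-≗ λ Y → cong (λ b → 𝟙 (b ∧ (v Y <ᵇ v (fromℕ N))))
                (<ᵇ-false (subst (toℕ Y ≤_) (sym (toℕ-fromℕ N)) (s≤s⁻¹ (toℕ<n Y))))) (∑-0 (suc N))

  inversions-insert-fixed : inversions (insert σ (fromℕ N)) ≡ inversions σ
  inversions-insert-fixed = begin
    inversions σ′  ≡⟨ inversions-insert (fromℕ N) ⟩
    ∑[ x < N ] (row (old σ′) x + 𝟙 (toℕ (extend (lookup σ) (fromℕ N)) <ᵇ old σ′ x))  ≡⟨ sum-cong-≗ unchanged ⟩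
    ∑[ x < N ] row (toℕ ∘ lookup σ) x                                                   ≡⟨ inversions-∑ σ ⟨
    inversions σ   ∎
    where
    σ′ = insert σ (fromℕ N)
    old≗ : ∀ x → old σ′ x ≡ toℕ (lookup σ x)
    old≗ x = trans (cong toℕ (insert-inject₁ σ (fromℕ N) x (fromℕ≢inject₁ ∘ sym))) (toℕ-inject₁ _)
    unchanged : ∀ x → row (old σ′) x + 𝟙 (toℕ (extend (lookup σ) (fromℕ N)) <ᵇ old σ′ x) ≡ row (toℕ ∘ lookup σ) x
    unchanged x = trans (cong₂ _+_ (row-cong old≗ x)
      (cong 𝟙 (<ᵇ-false (subst₂ _≤_ (sym (old≗ x)) (sym (trans (cong toℕ (extend-fromℕ _)) (toℕ-fromℕ N))) (<⇒≤ (toℕ<n (lookup σ x)))))))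
      (+-identityʳ _)

  inversions-insert-slot : IsPerm σ → ∀ a → ∃[ E ] inversions (insert σ (inject₁ a)) ≡ inversions σ + suc (E + E)
  inversions-insert-slot σ! a = E , (begin
    inversions σ′  ≡⟨ inversions-insert (inject₁ a) ⟩
    ∑[ x < N ] (row (old σ′) x + 𝟙 (toℕ (extend (lookup σ) (inject₁ a)) <ᵇ old σ′ x))
      ≡⟨ sum-cong-≗ (λ x → cong (λ u → row (old σ′) x + 𝟙 (u <ᵇ old σ′ x)) (trans (cong toℕ (extend-inject₁ _ a)) (toℕ-inject₁ _))) ⟩
    ∑[ x < N ] (row (old σ′) x + 𝟙 (toℕ (lookup σ a) <ᵇ old σ′ x)) ≡⟨ inversions-raise ⟩
    ∑[ x < N ] row (toℕ ∘ lookup σ) x + suc (E + E)                ≡⟨ cong (_+ suc (E + E)) (inversions-∑ σ) ⟨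
    inversions σ + suc (E + E) ∎)
    where
    σ′ = insert σ (inject₁ a)
    open RaiseToMaximum (toℕ ∘ lookup σ) (old σ′) a (σ! ∘ Fin.toℕ-injective) (toℕ<n ∘ lookup σ)
      (λ x x≢a → trans (cong toℕ (insert-inject₁ σ (inject₁ a) x (x≢a ∘ Fin.inject₁-injective))) (toℕ-inject₁ _))
      (trans (cong toℕ (insert-slot σ (inject₁ a))) (toℕ-fromℕ N))

%2-cases : ∀ x → x % 2 ≡ 0 ⊎ x % 2 ≡ 1
%2-cases x with x % 2 | m%n<n x 2
... | 0 | _ = inj₁ refl
... | 1 | _ = inj₂ refl
... | suc (suc _) | s≤s (s≤s ())

≡ᵇ-%2 : ∀ x y → (x % 2 ≡ᵇ y % 2) ≡ (0 ≡ᵇ (x + y) % 2)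
≡ᵇ-%2 x y = trans (bits (%2-cases x) (%2-cases y)) (cong (0 ≡ᵇ_) (sym (%-distribˡ-+ x y 2)))
  where
  bits : ∀ {a b} → a ≡ 0 ⊎ a ≡ 1 → b ≡ 0 ⊎ b ≡ 1 → (a ≡ᵇ b) ≡ (0 ≡ᵇ (a + b) % 2)
  bits (inj₁ refl) (inj₁ refl) = refl
  bits (inj₁ refl) (inj₂ refl) = refl
  bits (inj₂ refl) (inj₁ refl) = refl
  bits (inj₂ refl) (inj₂ refl) = refl

≡ᵇ-%2-suc : ∀ x y → (suc x % 2 ≡ᵇ y % 2) ≡ (x % 2 ≡ᵇ suc y % 2)
≡ᵇ-%2-suc x y = trans (≡ᵇ-%2 (suc x) y) (trans (cong (λ z → 0 ≡ᵇ z % 2) (sym (+-suc x y))) (sym (≡ᵇ-%2 x (suc y))))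

%2-suc-cong : ∀ {x y} → x % 2 ≡ y % 2 → suc x % 2 ≡ suc y % 2
%2-suc-cong {x} {y} e = trans (%-distribˡ-+ 1 x 2) (trans (cong (λ z → (1 + z) % 2) e) (sym (%-distribˡ-+ 1 y 2)))

𝟙-%2-complement : ∀ x y → 𝟙 (x % 2 ≡ᵇ y % 2) + 𝟙 (x % 2 ≡ᵇ suc y % 2) ≡ 1
𝟙-%2-complement x y = begin
  𝟙 (x % 2 ≡ᵇ y % 2) + 𝟙 (x % 2 ≡ᵇ suc y % 2)
    ≡⟨ cong₂ (λ b c → 𝟙 b + 𝟙 c) (≡ᵇ-%2 x y) (trans (≡ᵇ-%2 x (suc y)) (cong (λ z → 0 ≡ᵇ z % 2) (+-suc x y))) ⟩
  𝟙 (0 ≡ᵇ (x + y) % 2) + 𝟙 (0 ≡ᵇ (1 + (x + y)) % 2)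
    ≡⟨ cong (λ z → 𝟙 (0 ≡ᵇ (x + y) % 2) + 𝟙 (0 ≡ᵇ z)) (%-distribˡ-+ 1 (x + y) 2) ⟩
  𝟙 (0 ≡ᵇ (x + y) % 2) + 𝟙 (0 ≡ᵇ (1 + (x + y) % 2) % 2)
    ≡⟨ bit (%2-cases (x + y)) ⟩
  1 ∎
  where
  bit : ∀ {c} → c ≡ 0 ⊎ c ≡ 1 → 𝟙 (0 ≡ᵇ c) + 𝟙 (0 ≡ᵇ (1 + c) % 2) ≡ 1
  bit (inj₁ refl) = refl
  bit (inj₂ refl) = refl

module _ {N : ℕ} (σ : Table N) where

  par-insert-fixed : par (insert σ (fromℕ N)) ≡ par σ
  par-insert-fixed = cong (_% 2) (inversions-insert-fixed σ)

  par-insert-slot : IsPerm σ → ∀ a → par (insert σ (inject₁ a)) ≡ suc (inversions σ) % 2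
  par-insert-slot σ! a with inversions-insert-slot σ σ! a
  ... | E , e = begin
    inversions (insert σ (inject₁ a)) % 2 ≡⟨ cong (_% 2) (trans e (odd-shift (inversions σ) E)) ⟩
    (suc (inversions σ) + E * 2) % 2      ≡⟨ [m+kn]%n≡m%n (suc (inversions σ)) E 2 ⟩
    suc (inversions σ) % 2                ∎
    where
    odd-shift : ∀ i e → i + suc (e + e) ≡ suc i + e * 2
    odd-shift = solve-∀

par≡cycles : ∀ {M} (σ : Table M) → IsPerm σ → par σ ≡ (M + numCycles σ) % 2
par≡cycles {zero}  []  _  = refl
par≡cycles {suc N} σ σ! with insert-surjective σ σ!
... | τ , p , refl with view p
...   | ‵fromℕ = begin
  par (insert τ (fromℕ N))                                     ≡⟨ par-insert-fixed τ ⟩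
  par τ                                                        ≡⟨ par≡cycles τ τ! ⟩
  (N + numCycles τ) % 2                                        ≡⟨ [m+n]%n≡m%n (N + numCycles τ) 2 ⟨
  (N + numCycles τ + 2) % 2                                    ≡⟨ cong (_% 2) (shift N (numCycles τ)) ⟩
  (suc N + (numCycles τ + 1)) % 2
    ≡⟨ cong₂ (λ c b → (suc N + (c + 𝟙 b)) % 2) (cyclesMeeting-≥ (suc N) τ (n≤1+n N)) (<ᵇ-true (n<1+n N)) ⟨
  (suc N + (cyclesMeeting (suc N) τ + 𝟙 (N <ᵇ suc N))) % 2
    ≡⟨ cong (λ c → (suc N + c) % 2) (cyclesMeeting-insert-fixed τ τ! (suc N)) ⟨
  (suc N + numCycles (insert τ (fromℕ N))) % 2                 ∎
  where
  τ! = isPerm-insert⁻ τ (fromℕ N) σ!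
  shift : ∀ n c → n + c + 2 ≡ suc n + (c + 1)
  shift = solve-∀
...   | ‵inj₁ {i = a} _ = begin
  par (insert τ (inject₁ a))                       ≡⟨ par-insert-slot τ τ! a ⟩
  suc (inversions τ) % 2                           ≡⟨ %2-suc-cong {inversions τ} {N + numCycles τ} (par≡cycles τ τ!) ⟩
  suc (N + numCycles τ) % 2                        ≡⟨ cong (λ c → (suc N + c) % 2) (cyclesMeeting-≥ (suc N) τ (n≤1+n N)) ⟨
  (suc N + cyclesMeeting (suc N) τ) % 2
    ≡⟨ cong (λ c → (suc N + c) % 2) (cyclesMeeting-insert-slot τ τ! (suc N) a) ⟨
  (suc N + numCycles (insert τ (inject₁ a))) % 2   ∎
  where
  τ! = isPerm-insert⁻ τ (inject₁ a) σ!

count-insert : ∀ N (P : Table (suc N) → Bool) → count P (perms (suc N)) ≡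
  sum (map (λ σ → ∑[ a < N ] 𝟙 (P (insert σ (inject₁ a))) + 𝟙 (P (insert σ (fromℕ N)))) (perms N))
count-insert N P = trans (sum-perms-suc N (𝟙 ∘ P))
  (sum-map-cong (perms N) (λ {σ} _ → sum-init-last (λ p → 𝟙 (P (insert σ p)))))

count-perms : ∀ M → count (const true) (perms M) ≡ M !
count-perms zero    = refl
count-perms (suc N) = begin
  count (const true) (perms (suc N))             ≡⟨ count-insert N (const true) ⟩
  sum (map (λ _ → ∑[ a < N ] 1 + 1) (perms N))
    ≡⟨ sum-map-cong (perms N) (λ _ → trans (cong (_+ 1) (∑-const N 1)) (+-comm (N * 1) 1)) ⟩
  sum (map (λ _ → suc N * 1) (perms N))          ≡⟨ sum-map-* (perms N) (suc N) (const 1) ⟩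
  suc N * count (const true) (perms N)           ≡⟨ cong (suc N *_) (count-perms N) ⟩
  suc N * N !                                    ∎

parityCount : ℕ → ℕ → ℕ
parityCount M j = count (λ σ → par σ ≡ᵇ j % 2) (perms M)

parityCount-suc : ∀ N j → parityCount (suc N) j ≡ parityCount N j + N * parityCount N (suc j)
parityCount-suc N j = begin
  parityCount (suc N) j ≡⟨ count-insert N (λ σ → par σ ≡ᵇ j % 2) ⟩
  sum (map (λ σ → ∑[ a < N ] 𝟙 (par (insert σ (inject₁ a)) ≡ᵇ j % 2) + 𝟙 (par (insert σ (fromℕ N)) ≡ᵇ j % 2)) (perms N))
    ≡⟨ sum-map-cong (perms N) (λ {σ} σ∈ → positions σ (to (∈-perms {σ = σ}) σ∈)) ⟩
  sum (map (λ σ → 𝟙 (par σ ≡ᵇ j % 2) + N * 𝟙 (par σ ≡ᵇ suc j % 2)) (perms N))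
    ≡⟨ sum-map-+ (perms N) (λ σ → 𝟙 (par σ ≡ᵇ j % 2)) (λ σ → N * 𝟙 (par σ ≡ᵇ suc j % 2)) ⟩
  parityCount N j + sum (map (λ σ → N * 𝟙 (par σ ≡ᵇ suc j % 2)) (perms N))
    ≡⟨ cong (parityCount N j +_) (sum-map-* (perms N) N (λ σ → 𝟙 (par σ ≡ᵇ suc j % 2))) ⟩
  parityCount N j + N * parityCount N (suc j) ∎
  where
  positions : ∀ σ → IsPerm σ →
    ∑[ a < N ] 𝟙 (par (insert σ (inject₁ a)) ≡ᵇ j % 2) + 𝟙 (par (insert σ (fromℕ N)) ≡ᵇ j % 2) ≡
    𝟙 (par σ ≡ᵇ j % 2) + N * 𝟙 (par σ ≡ᵇ suc j % 2)
  positions σ σ! = begin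
    ∑[ a < N ] 𝟙 (par (insert σ (inject₁ a)) ≡ᵇ j % 2) + 𝟙 (par (insert σ (fromℕ N)) ≡ᵇ j % 2)
      ≡⟨ cong₂ _+_ (sum-cong-≗ (λ a → cong 𝟙 (trans (cong (_≡ᵇ j % 2) (par-insert-slot σ σ! a)) (≡ᵇ-%2-suc (inversions σ) j))))
                   (cong (λ q → 𝟙 (q ≡ᵇ j % 2)) (par-insert-fixed σ)) ⟩
    ∑[ a < N ] 𝟙 (par σ ≡ᵇ suc j % 2) + 𝟙 (par σ ≡ᵇ j % 2)
      ≡⟨ cong (_+ 𝟙 (par σ ≡ᵇ j % 2)) (∑-const N (𝟙 (par σ ≡ᵇ suc j % 2))) ⟩
    N * 𝟙 (par σ ≡ᵇ suc j % 2) + 𝟙 (par σ ≡ᵇ j % 2)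
      ≡⟨ +-comm (N * 𝟙 (par σ ≡ᵇ suc j % 2)) _ ⟩
    𝟙 (par σ ≡ᵇ j % 2) + N * 𝟙 (par σ ≡ᵇ suc j % 2) ∎

parityCount-balanced : ∀ k j → parityCount (2 + k) j ≡ parityCount (2 + k) (suc j)
parityCount-balanced zero j = begin
  parityCount 2 j                          ≡⟨ parityCount-suc 1 j ⟩
  parityCount 1 j + 1 * parityCount 1 (suc j)
    ≡⟨ cong₂ _+_ (sym (*-identityˡ (parityCount 1 j))) (*-identityˡ (parityCount 1 (suc j))) ⟩
  1 * parityCount 1 j + parityCount 1 (suc j) ≡⟨ +-comm (1 * parityCount 1 j) _ ⟩
  parityCount 1 (suc j) + 1 * parityCount 1 j ≡⟨ parityCount-suc 1 (suc j) ⟨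
  parityCount 2 (suc j)                    ∎
parityCount-balanced (suc k) j = begin
  parityCount (3 + k) j                                        ≡⟨ parityCount-suc (2 + k) j ⟩
  parityCount (2 + k) j + (2 + k) * parityCount (2 + k) (suc j)
    ≡⟨ cong₂ (λ x y → x + (2 + k) * y) (parityCount-balanced k j) (sym (parityCount-balanced k j)) ⟩
  parityCount (2 + k) (suc j) + (2 + k) * parityCount (2 + k) j ≡⟨ parityCount-suc (2 + k) (suc j) ⟨
  parityCount (3 + k) (suc j)                                  ∎

parityCount-complement : ∀ M j → parityCount M j + parityCount M (suc j) ≡ M !
parityCount-complement M j = begin
  parityCount M j + parityCount M (suc j)  ≡⟨ sum-map-+ (perms M) (λ σ → 𝟙 (par σ ≡ᵇ j % 2)) (λ σ → 𝟙 (par σ ≡ᵇ suc j % 2)) ⟨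
  sum (map (λ σ → 𝟙 (par σ ≡ᵇ j % 2) + 𝟙 (par σ ≡ᵇ suc j % 2)) (perms M))
    ≡⟨ sum-map-cong (perms M) (λ {σ} _ → 𝟙-%2-complement (inversions σ) j) ⟩
  count (const true) (perms M)             ≡⟨ count-perms M ⟩
  M !                                      ∎

parityCount-half : ∀ M j → 2 ≤ M → parityCount M j ≡ M ! / 2
parityCount-half (suc zero) j (s≤s ())
parityCount-half (suc (suc k)) j _ = sym (begin
  (2 + k) ! / 2                       ≡⟨ cong (_/ 2) (parityCount-complement (2 + k) j) ⟨
  (P + parityCount (2 + k) (suc j)) / 2 ≡⟨ cong (λ c → (P + c) / 2) (parityCount-balanced k j) ⟨
  (P + P) / 2                         ≡⟨ cong (_/ 2) (trans (cong (P +_) (sym (+-identityʳ P))) (*-comm 2 P)) ⟩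
  P * 2 / 2                           ≡⟨ m*n/n≡m P 2 ⟩
  P                                   ∎)
  where P = parityCount (2 + k) j

-- The index j is a parity offset (see parityIs).
record Family (r : ℕ) : Set₁ where
  field
    holds : ℕ → ∀ {M} → Table M → Bool
    holds-fixed : ∀ j {N} → r ≤ N → (σ : Table N) → IsPerm σ → holds j (insert σ (fromℕ N)) ≡ holds j σ
    holds-slot : ∀ j {N} → r ≤ N → (σ : Table N) → IsPerm σ → ∀ a → holds j (insert σ (inject₁ a)) ≡ holds (suc j) σ

open Family public

module _ {r : ℕ} where

  invariant : (P : ∀ {M} → Table M → Bool) →
              (∀ {N} → r ≤ N → (σ : Table N) → IsPerm σ → ∀ p → P (insert σ p) ≡ P σ) → Family r
  invariant P P-insert = record
    { holds       = λ _ → P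
    ; holds-fixed = λ _ {N} r≤N σ σ! → P-insert r≤N σ σ! (fromℕ N)
    ; holds-slot  = λ _ r≤N σ σ! a → P-insert r≤N σ σ! (inject₁ a)
    }

  parityIs : ℕ → Family r
  parityIs c = record
    { holds       = λ j σ → par σ ≡ᵇ (c + j) % 2
    ; holds-fixed = λ j _ σ _ → cong (_≡ᵇ (c + j) % 2) (par-insert-fixed σ)
    ; holds-slot  = λ j _ σ σ! a → trans (cong (_≡ᵇ (c + j) % 2) (par-insert-slot σ σ! a))
                                    (trans (≡ᵇ-%2-suc (inversions σ) (c + j)) (cong (λ k → par σ ≡ᵇ k % 2) (sym (+-suc c j))))
    }

  _∧ᶠ_ : Family r → Family r → Family r
  F ∧ᶠ G = record
    { holds       = λ j σ → holds F j σ ∧ holds G j σ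
    ; holds-fixed = λ j r≤N σ σ! → cong₂ _∧_ (holds-fixed F j r≤N σ σ!) (holds-fixed G j r≤N σ σ!)
    ; holds-slot  = λ j r≤N σ σ! a → cong₂ _∧_ (holds-slot F j r≤N σ σ! a) (holds-slot G j r≤N σ σ! a)
    }

  always : Family r
  always = invariant (const true) (λ _ _ _ _ → refl)

  cyclesMeetingIs : ℕ → Family r
  cyclesMeetingIs k = invariant (λ σ → cyclesMeeting r σ ≡ᵇ k) (λ r≤N σ σ! p → cong (_≡ᵇ k) (unchanged r≤N σ σ! p))
    where
    unchanged : ∀ {N} → r ≤ N → (σ : Table N) → IsPerm σ → ∀ p → cyclesMeeting r (insert σ p) ≡ cyclesMeeting r σ
    unchanged {N} r≤N σ σ! p with view p
    ... | ‵fromℕ = trans (cyclesMeeting-insert-fixed σ σ! r) (trans (cong (λ b → cyclesMeeting r σ + 𝟙 b) (<ᵇ-false r≤N)) (+-identityʳ _))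
    ... | ‵inj₁ {i = a} _ = cyclesMeeting-insert-slot σ σ! r a

  separatedᶠ : Family r
  separatedᶠ = invariant (separated r) separated-insert

atPred : (ℕ → ℕ) → ℕ → ℕ
atPred X zero    = 0
atPred X (suc m) = X m

*-𝟙-pin : ∀ b {x y} → (T b → x ≡ y) → x * 𝟙 b ≡ y * 𝟙 b
*-𝟙-pin true  x≡y = cong (_* 1) (x≡y _)
*-𝟙-pin false {x} {y} _ = trans (*-zeroʳ x) (sym (*-zeroʳ y))

three-kinds : ∀ {S S′ F F′ : ℕ} c₁ c₂ → 𝟙 c₁ + S′ ≡ S → 𝟙 c₂ + F′ ≡ F → ¬ (T c₁ × T c₂) → ∀ u m h →
  𝟙 ((S′ ≡ᵇ u) ∧ (F′ ≡ᵇ m) ∧ h) ≡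
  𝟙 c₁ * 𝟙 ((S ≡ᵇ suc u) ∧ (F ≡ᵇ m) ∧ h) + 𝟙 c₂ * 𝟙 ((S ≡ᵇ u) ∧ (F ≡ᵇ suc m) ∧ h)
    + 𝟙 (not c₁ ∧ not c₂) * 𝟙 ((S ≡ᵇ u) ∧ (F ≡ᵇ m) ∧ h)
three-kinds true  true  _    _    both u m h = contradiction (_ , _) both
three-kinds true  false refl refl _    u m h = first _
  where first : ∀ k → k ≡ 1 * k + 0 + 0
        first = solve-∀
three-kinds false true  refl refl _    u m h = second _
  where second : ∀ k → k ≡ 0 + 1 * k + 0
        second = solve-∀
three-kinds false false refl refl _    u m h = third _
  where third : ∀ k → k ≡ 0 + 0 + 1 * k
        third = solve-∀

𝟙-one-of-three : ∀ c₁ c₂ → ¬ (T c₁ × T c₂) → 𝟙 c₁ + 𝟙 c₂ + 𝟙 (not c₁ ∧ not c₂) ≡ 1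
𝟙-one-of-three true  true  both = contradiction (_ , _) both
𝟙-one-of-three true  false _    = refl
𝟙-one-of-three false true  _    = refl
𝟙-one-of-three false false _    = refl

sum-map-atPred : ∀ {A : Set} (f : A → ℕ → ℕ) xs m →
  sum (map (λ x → atPred (f x) m) xs) ≡ atPred (λ m′ → sum (map (λ x → f x m′) xs)) m
sum-map-atPred f xs (suc m) = refl
sum-map-atPred f xs zero    = zeros xs
  where zeros : ∀ xs → sum (map (λ x → atPred (f x) zero) xs) ≡ 0
        zeros []       = refl
        zeros (x ∷ xs) = zeros xs

module Recurrence (r : ℕ) (ψ : ℕ → ℕ → Bool) (ψ⊆R : InsideR r ψ) (F : Family r) where

  Holds : ℕ → ℕ → ℕ → ∀ {M} → Table M → Bool
  Holds u m j σ = (pairCount ψ σ ≡ᵇ u) ∧ (fixedOutR r σ ≡ᵇ m) ∧ holds F j σ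

  Count : ℕ → ℕ → ℕ → ℕ → ℕ
  Count M u m j = count (Holds u m j) (perms M)

  module _ {N : ℕ} (r≤N : r ≤ N) (σ : Table N) (σ! : IsPerm σ) (u m j : ℕ) where

    private
      ψ-pos fix-pos other-pos : Fin N → Bool
      ψ-pos a     = ψ (toℕ a) (toℕ (lookup σ a))
      fix-pos a   = fixedOutside r (toℕ a) (toℕ (lookup σ a))
      other-pos a = not (ψ-pos a) ∧ not (fix-pos a)

      disjoint : ∀ a → ¬ (T (ψ-pos a) × T (fix-pos a))
      disjoint a (ψa , fixa) =
        subst T (to T-not-≡ (proj₁ (to (T-∧ {not (toℕ a <ᵇ r)}) fixa))) (<⇒<ᵇ (proj₁ (ψ⊆R ψa)))

      K₁ K₂ K₃ : ℕ
      K₁ = 𝟙 (Holds (suc u) m (suc j) σ)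
      K₂ = 𝟙 (Holds u (suc m) (suc j) σ)
      K₃ = 𝟙 (Holds u m (suc j) σ)

      fixed-term : ∀ k → 𝟙 (Holds u k j (insert σ (fromℕ N))) ≡ atPred (λ m′ → 𝟙 (Holds u m′ j σ)) k
      fixed-term k
        rewrite insideR-insert-fixed r≤N σ ψ⊆R | fixedOutR-insert-fixed r≤N σ | holds-fixed F j r≤N σ σ!
        = new-fixed-point k
        where
        new-fixed-point : ∀ k → 𝟙 ((pairCount ψ σ ≡ᵇ u) ∧ (suc (fixedOutR r σ) ≡ᵇ k) ∧ holds F j σ) ≡
                                atPred (λ m′ → 𝟙 (Holds u m′ j σ)) k
        new-fixed-point zero    = cong 𝟙 (∧-zeroʳ _)
        new-fixed-point (suc k) = refl

      slot-term : ∀ a → 𝟙 (Holds u m j (insert σ (inject₁ a))) ≡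
                        𝟙 (ψ-pos a) * K₁ + 𝟙 (fix-pos a) * K₂ + 𝟙 (other-pos a) * K₃
      slot-term a rewrite holds-slot F j r≤N σ σ! a = three-kinds (ψ-pos a) (fix-pos a)
        (trans (+-comm (𝟙 (ψ-pos a)) _) (insideR-insert-slot r≤N σ ψ⊆R a))
        (trans (+-comm (𝟙 (fix-pos a)) _) (fixedOutR-insert-slot r≤N σ a))
        (disjoint a) u m (holds F (suc j) σ)

      Holds⇒ : ∀ {u m j} → T (Holds u m j σ) → pairCount ψ σ ≡ u × fixedOutR r σ ≡ m
      Holds⇒ {u} {m} t = let S≡u , rest = to (T-∧ {pairCount ψ σ ≡ᵇ u}) t in
        ≡ᵇ⇒≡ _ _ S≡u , ≡ᵇ⇒≡ _ _ (proj₁ (to (T-∧ {fixedOutR r σ ≡ᵇ m}) rest))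

      others : ∑[ a < N ] 𝟙 (other-pos a) ≡ N ∸ pairCount ψ σ ∸ fixedOutR r σ
      others = sym (begin
        N ∸ S ∸ Fo                             ≡⟨ cong (λ n → n ∸ S ∸ Fo) total ⟨
        S + Fo + ∑[ a < N ] 𝟙 (other-pos a) ∸ S ∸ Fo ≡⟨ cong (_∸ Fo) (trans (cong (_∸ S) (+-assoc S Fo _)) (m+n∸m≡n S _)) ⟩
        Fo + ∑[ a < N ] 𝟙 (other-pos a) ∸ Fo  ≡⟨ m+n∸m≡n Fo _ ⟩
        ∑[ a < N ] 𝟙 (other-pos a)             ∎)
        where
        S = pairCount ψ σ
        Fo = fixedOutR r σ
        total : S + Fo + ∑[ a < N ] 𝟙 (other-pos a) ≡ N
        total = begin
          S + Fo + ∑[ a < N ] 𝟙 (other-pos a)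
            ≡⟨ cong₂ (λ x y → x + y + ∑[ a < N ] 𝟙 (other-pos a)) (sum-map-allFin (𝟙 ∘ ψ-pos)) (sum-map-allFin (𝟙 ∘ fix-pos)) ⟩
          ∑[ a < N ] 𝟙 (ψ-pos a) + ∑[ a < N ] 𝟙 (fix-pos a) + ∑[ a < N ] 𝟙 (other-pos a)
            ≡⟨ cong (_+ ∑[ a < N ] 𝟙 (other-pos a)) (∑-distrib-+ (𝟙 ∘ ψ-pos) (𝟙 ∘ fix-pos)) ⟨
          ∑[ a < N ] (𝟙 (ψ-pos a) + 𝟙 (fix-pos a)) + ∑[ a < N ] 𝟙 (other-pos a)
            ≡⟨ ∑-distrib-+ (λ a → 𝟙 (ψ-pos a) + 𝟙 (fix-pos a)) (𝟙 ∘ other-pos) ⟨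
          ∑[ a < N ] (𝟙 (ψ-pos a) + 𝟙 (fix-pos a) + 𝟙 (other-pos a))
            ≡⟨ sum-cong-≗ (λ a → 𝟙-one-of-three (ψ-pos a) (fix-pos a) (disjoint a)) ⟩
          ∑[ a < N ] 1 ≡⟨ trans (∑-const N 1) (*-identityʳ N) ⟩
          N ∎

    positions : ∑[ a < N ] 𝟙 (Holds u m j (insert σ (inject₁ a))) + 𝟙 (Holds u m j (insert σ (fromℕ N))) ≡
      atPred (λ m′ → 𝟙 (Holds u m′ j σ)) m + suc u * K₁ + suc m * K₂ + (N ∸ u ∸ m) * K₃
    positions = begin
      ∑[ a < N ] 𝟙 (Holds u m j (insert σ (inject₁ a))) + 𝟙 (Holds u m j (insert σ (fromℕ N)))
        ≡⟨ cong₂ _+_ (sum-cong-≗ slot-term) (fixed-term m) ⟩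
      ∑[ a < N ] (𝟙 (ψ-pos a) * K₁ + 𝟙 (fix-pos a) * K₂ + 𝟙 (other-pos a) * K₃) + P
        ≡⟨ cong (_+ P) (trans (∑-distrib-+ (λ a → 𝟙 (ψ-pos a) * K₁ + 𝟙 (fix-pos a) * K₂) (λ a → 𝟙 (other-pos a) * K₃))
                        (cong (_+ ∑[ a < N ] (𝟙 (other-pos a) * K₃)) (∑-distrib-+ (λ a → 𝟙 (ψ-pos a) * K₁) (λ a → 𝟙 (fix-pos a) * K₂)))) ⟩
      ∑[ a < N ] (𝟙 (ψ-pos a) * K₁) + ∑[ a < N ] (𝟙 (fix-pos a) * K₂) + ∑[ a < N ] (𝟙 (other-pos a) * K₃) + P
        ≡⟨ cong (_+ P) (cong₂ _+_ (cong₂ _+_ (∑-distribʳ-* K₁ (𝟙 ∘ ψ-pos)) (∑-distribʳ-* K₂ (𝟙 ∘ fix-pos))) (∑-distribʳ-* K₃ (𝟙 ∘ other-pos))) ⟩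
      ∑[ a < N ] 𝟙 (ψ-pos a) * K₁ + ∑[ a < N ] 𝟙 (fix-pos a) * K₂ + ∑[ a < N ] 𝟙 (other-pos a) * K₃ + P
        ≡⟨ cong (_+ P) (cong₂ _+_ (cong₂ _+_ (cong (_* K₁) (sum-map-allFin (𝟙 ∘ ψ-pos))) (cong (_* K₂) (sum-map-allFin (𝟙 ∘ fix-pos)))) (cong (_* K₃) (sym others))) ⟨
      pairCount ψ σ * K₁ + fixedOutR r σ * K₂ + (N ∸ pairCount ψ σ ∸ fixedOutR r σ) * K₃ + P
        ≡⟨ cong (_+ P) (cong₂ _+_ (cong₂ _+_ (*-𝟙-pin _ (proj₁ ∘ Holds⇒)) (*-𝟙-pin _ (proj₂ ∘ Holds⇒)))
                                  (*-𝟙-pin _ (λ t → cong₂ (λ x y → N ∸ x ∸ y) (proj₁ (Holds⇒ t)) (proj₂ (Holds⇒ t))))) ⟩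
      suc u * K₁ + suc m * K₂ + (N ∸ u ∸ m) * K₃ + P
        ≡⟨ rotate (suc u * K₁) (suc m * K₂) ((N ∸ u ∸ m) * K₃) P ⟩
      P + suc u * K₁ + suc m * K₂ + (N ∸ u ∸ m) * K₃ ∎
      where
      P = atPred (λ m′ → 𝟙 (Holds u m′ j σ)) m
      rotate : ∀ a b c p → a + b + c + p ≡ p + a + b + c
      rotate = solve-∀

  recurrence : ∀ {N} → r ≤ N → ∀ u m j → Count (suc N) u m j ≡
    atPred (λ m′ → Count N u m′ j) m + suc u * Count N (suc u) m (suc j)
      + suc m * Count N u (suc m) (suc j) + (N ∸ u ∸ m) * Count N u m (suc j)
  recurrence {N} r≤N u m j = begin
    Count (suc N) u m j ≡⟨ count-insert N (Holds u m j) ⟩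
    sum (map (λ σ → ∑[ a < N ] 𝟙 (Holds u m j (insert σ (inject₁ a))) + 𝟙 (Holds u m j (insert σ (fromℕ N)))) (perms N))
      ≡⟨ sum-map-cong (perms N) (λ {σ} σ∈ → positions r≤N σ (to (∈-perms {σ = σ}) σ∈) u m j) ⟩
    sum (map (λ σ → P σ + suc u * k₁ σ + suc m * k₂ σ + (N ∸ u ∸ m) * k₃ σ) (perms N))
      ≡⟨ sum-map-+ (perms N) (λ σ → P σ + suc u * k₁ σ + suc m * k₂ σ) (λ σ → (N ∸ u ∸ m) * k₃ σ) ⟩
    sum (map (λ σ → P σ + suc u * k₁ σ + suc m * k₂ σ) (perms N)) + sum (map (λ σ → (N ∸ u ∸ m) * k₃ σ) (perms N))
      ≡⟨ cong₂ _+_ (trans (sum-map-+ (perms N) (λ σ → P σ + suc u * k₁ σ) (λ σ → suc m * k₂ σ))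
                          (cong₂ _+_ (trans (sum-map-+ (perms N) P (λ σ → suc u * k₁ σ))
                                            (cong₂ _+_ (sum-map-atPred (λ σ m′ → 𝟙 (Holds u m′ j σ)) (perms N) m)
                                                       (sum-map-* (perms N) (suc u) k₁)))
                                     (sum-map-* (perms N) (suc m) k₂)))
                   (sum-map-* (perms N) (N ∸ u ∸ m) k₃) ⟩
    atPred (λ m′ → Count N u m′ j) m + suc u * Count N (suc u) m (suc j)
      + suc m * Count N u (suc m) (suc j) + (N ∸ u ∸ m) * Count N u m (suc j) ∎
    where
    P k₁ k₂ k₃ : Table N → ℕ
    P σ = atPred (λ m′ → 𝟙 (Holds u m′ j σ)) m
    k₁ σ = 𝟙 (Holds (suc u) m (suc j) σ)
    k₂ σ = 𝟙 (Holds u (suc m) (suc j) σ)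
    k₃ σ = 𝟙 (Holds u m (suc j) σ)

separatedPair-same : ∀ r i s → separatedPair r i i s ≡ true
separatedPair-same r i s rewrite ≡ᵇ-refl i | ∧-zeroʳ (i <ᵇ r) | ∧-zeroʳ (i <ᵇ r) = refl

separatedPair-inside : ∀ {r i j} → i < r → j < r → T (separatedPair r i j true) → i ≡ j
separatedPair-inside {r} {i} {j} i<r j<r t rewrite <ᵇ-true i<r | <ᵇ-true j<r =
  ≡ᵇ⇒≡ i j (subst T (trans (∨-identityʳ _) (not-involutive _)) t)

iter-identity : ∀ {M} j (x : Fin M) → iter (identity M) j x ≡ x
iter-identity zero    x = refl
iter-identity (suc j) x = trans (cong (lookup (identity _)) (iter-identity j x)) (lookup-allFin x)

identity-isPerm : ∀ {M} → IsPerm (identity M)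
identity-isPerm {x = x} {y} e = trans (sym (lookup-allFin x)) (trans e (lookup-allFin y))

par-identity : ∀ M → par (identity M) ≡ 0
par-identity M = cong (_% 2) (trans (inversions-∑ (identity M))
  (trans (sum-cong-≗ (λ x → trans (sum-cong-≗ (no-inversion x)) (∑-0 M))) (∑-0 M)))
  where
  no-inversion : ∀ x y → 𝟙 ((toℕ x <ᵇ toℕ y) ∧ (toℕ (lookup (identity M) y) <ᵇ toℕ (lookup (identity M) x))) ≡ 0
  no-inversion x y rewrite lookup-allFin x | lookup-allFin y =
    𝟙-¬T (λ t → let x<y , y<x = to (T-∧ {toℕ x <ᵇ toℕ y}) t in <-asym (<ᵇ⇒< (toℕ x) (toℕ y) x<y) (<ᵇ⇒< (toℕ y) (toℕ x) y<x))

separated-identity : ∀ r M → T (separated r (identity M))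
separated-identity r M = from (T-allFin? _) λ x → from (T-allFin? _) λ y → pair x y
  where
  pair : ∀ x y → T (separatedPair r (toℕ x) (toℕ y) (sameCycle (identity M) x y))
  pair x y with sameCycle (identity M) x y in e
  ... | false = from T-≡ (∨-zeroʳ _)
  ... | true with to (sameCycle-reflects (identity M) identity-isPerm) (subst T (sym e) _)
  ...   | j , iterate≡y with trans (sym (iter-identity j x)) iterate≡y
  ...     | refl = from T-≡ (separatedPair-same r (toℕ x) true)

module Inside {r M : ℕ} (M≤r : M ≤ r) where

  inside : ∀ (x : Fin M) → toℕ x < r
  inside x = <-≤-trans (toℕ<n x) M≤r

  stayInR-inside : (σ : Table M) → stayInR r σ ≡ M
  stayInR-inside σ = countFin-all λ x → from T-∧ (<⇒<ᵇ (inside x) , <⇒<ᵇ (inside (lookup σ x)))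

  fixedOutR-inside : (σ : Table M) → fixedOutR r σ ≡ 0
  fixedOutR-inside σ = countFin-none λ x t →
    subst T (to T-not-≡ (proj₁ (to (T-∧ {not (toℕ x <ᵇ r)}) t))) (<⇒<ᵇ (inside x))

  fixedInR-identity : fixedInR r (identity M) ≡ M
  fixedInR-identity = countFin-all λ x → from T-∧ (<⇒<ᵇ (inside x) , from ≟ᶠ-reflects (lookup-allFin x))

  separated⇒identity : (σ : Table M) → IsPerm σ → T (separated r σ) → σ ≡ identity M
  separated⇒identity σ σ! t = lookup-ext λ x → trans (sym (fixed x)) (sym (lookup-allFin x))
    where
    fixed : ∀ x → x ≡ lookup σ x
    fixed x = toℕ-injective (separatedPair-inside (inside x) (inside (lookup σ x))
      (subst (T ∘ separatedPair r (toℕ x) (toℕ (lookup σ x)))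
             (to T-≡ (from (sameCycle-reflects σ σ!) (1 , refl)))
             (to (T-allFin? _) (to (T-allFin? _) t x) (lookup σ x))))

SatisfiesRecurrence : ℕ → (ℕ → ℕ → ℕ → ℕ → ℕ) → Set
SatisfiesRecurrence r X = ∀ n u m j → X (suc n) u m j ≡
  atPred (λ m′ → X n u m′ j) m + suc u * X n (suc u) m (suc j)
    + suc m * X n u (suc m) (suc j) + (r + n ∸ u ∸ m) * X n u m (suc j)

proportional : ∀ {r} (X Y : ℕ → ℕ → ℕ → ℕ → ℕ) c → SatisfiesRecurrence r X → SatisfiesRecurrence r Y →
               (∀ u m j → X 0 u m j ≡ c * Y 0 u m j) → ∀ n u m j → X n u m j ≡ c * Y n u m j
proportional X Y c X-rec Y-rec base zero    u m j = base u m j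
proportional {r} X Y c X-rec Y-rec base (suc n) u m j = begin
  X (suc n) u m j
    ≡⟨ X-rec n u m j ⟩
  atPred (λ m′ → X n u m′ j) m + suc u * X n (suc u) m (suc j) + suc m * X n u (suc m) (suc j) + d * X n u m (suc j)
    ≡⟨ cong₂ _+_ (cong₂ _+_ (cong₂ _+_ (atPred-scaled m) (cong (suc u *_) (IH (suc u) m (suc j))))
                                       (cong (suc m *_) (IH u (suc m) (suc j))))
                 (cong (d *_) (IH u m (suc j))) ⟩
  c * P + suc u * (c * Y n (suc u) m (suc j)) + suc m * (c * Y n u (suc m) (suc j)) + d * (c * Y n u m (suc j))
    ≡⟨ factor c P (suc u) (Y n (suc u) m (suc j)) (suc m) (Y n u (suc m) (suc j)) d (Y n u m (suc j)) ⟩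
  c * (P + suc u * Y n (suc u) m (suc j) + suc m * Y n u (suc m) (suc j) + d * Y n u m (suc j))
    ≡⟨ cong (c *_) (Y-rec n u m j) ⟨
  c * Y (suc n) u m j ∎
  where
  IH = proportional X Y c X-rec Y-rec base n
  d = r + n ∸ u ∸ m
  P = atPred (λ m′ → Y n u m′ j) m
  atPred-scaled : ∀ k → atPred (λ m′ → X n u m′ j) k ≡ c * atPred (λ m′ → Y n u m′ j) k
  atPred-scaled zero    = sym (*-zeroʳ c)
  atPred-scaled (suc k) = IH u k j
  factor : ∀ c p a y₁ b y₂ e y₃ → c * p + a * (c * y₁) + b * (c * y₂) + e * (c * y₃) ≡ c * (p + a * y₁ + b * y₂ + e * y₃)
  factor = solve-∀

module _ (r : ℕ) where

  staysInside fixedInside : ℕ → ℕ → Bool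
  staysInside i v = (i <ᵇ r) ∧ (v <ᵇ r)
  fixedInside i v = (i <ᵇ r) ∧ (v ≡ᵇ i)

  staysInside⊆R : InsideR r staysInside
  staysInside⊆R {i} t = let i<r , v<r = to (T-∧ {i <ᵇ r}) t in <ᵇ⇒< _ r i<r , <ᵇ⇒< _ r v<r

  fixedInside⊆R : InsideR r fixedInside
  fixedInside⊆R {i} {v} t = let i<r , v≡i = to (T-∧ {i <ᵇ r}) t in
    <ᵇ⇒< i r i<r , subst (_< r) (sym (≡ᵇ⇒≡ v i v≡i)) (<ᵇ⇒< i r i<r)

  module D F = Recurrence r staysInside staysInside⊆R F
  module Sep G = Recurrence r fixedInside fixedInside⊆R (separatedᶠ ∧ᶠ G)

  count-recurrence : ∀ ψ (ψ⊆R : InsideR r ψ) F → SatisfiesRecurrence r (λ n → Recurrence.Count r ψ ψ⊆R F (r + n))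
  count-recurrence ψ ψ⊆R F n u m j =
    trans (cong (λ M → Recurrence.Count r ψ ψ⊆R F M u m j) (+-suc r n)) (Recurrence.recurrence r ψ ψ⊆R F (m≤m+n r n) u m j)

  module _ (F G : Family r) (c : ℕ)
           (at-r : ∀ j → count (holds F j) (perms (r + 0)) ≡ c * 𝟙 (holds G j (identity (r + 0)))) where

    private
      open Inside (≤-reflexive (+-identityʳ r))

      δ : ℕ → ℕ → ℕ
      δ u m = 𝟙 (((r + 0) ≡ᵇ u) ∧ (0 ≡ᵇ m))

      𝟙-split : ∀ a b h → 𝟙 (a ∧ b ∧ h) ≡ 𝟙 (a ∧ b) * 𝟙 h
      𝟙-split a b h = trans (cong 𝟙 (sym (∧-assoc a b h))) (𝟙-∧ (a ∧ b) h)

      D-at-r : ∀ u m j → D.Count F (r + 0) u m j ≡ δ u m * count (holds F j) (perms (r + 0))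
      D-at-r u m j = trans (sum-map-cong (perms (r + 0)) (λ {σ} _ → begin
          𝟙 ((stayInR r σ ≡ᵇ u) ∧ (fixedOutR r σ ≡ᵇ m) ∧ holds F j σ)
            ≡⟨ cong₂ (λ S Fo → 𝟙 ((S ≡ᵇ u) ∧ (Fo ≡ᵇ m) ∧ holds F j σ)) (stayInR-inside σ) (fixedOutR-inside σ) ⟩
          𝟙 (((r + 0) ≡ᵇ u) ∧ (0 ≡ᵇ m) ∧ holds F j σ)
            ≡⟨ 𝟙-split ((r + 0) ≡ᵇ u) (0 ≡ᵇ m) (holds F j σ) ⟩
          δ u m * 𝟙 (holds F j σ) ∎))
        (sum-map-* (perms (r + 0)) (δ u m) (𝟙 ∘ holds F j))

      Sep-at-r : ∀ u m j → Sep.Count G (r + 0) u m j ≡ δ u m * 𝟙 (holds G j (identity (r + 0)))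
      Sep-at-r u m j = begin
        Sep.Count G (r + 0) u m j
          ≡⟨ count-unique (Sep.Holds G u m j) (perms-unique (r + 0)) (from (∈-perms {σ = ι}) identity-isPerm) only ⟩
        𝟙 ((fixedInR r ι ≡ᵇ u) ∧ (fixedOutR r ι ≡ᵇ m) ∧ (separated r ι ∧ holds G j ι))
          ≡⟨ cong₂ (λ S s → 𝟙 ((S ≡ᵇ u) ∧ (fixedOutR r ι ≡ᵇ m) ∧ (s ∧ holds G j ι)))
                   fixedInR-identity (to T-≡ (separated-identity r (r + 0))) ⟩
        𝟙 (((r + 0) ≡ᵇ u) ∧ (fixedOutR r ι ≡ᵇ m) ∧ holds G j ι)
          ≡⟨ cong (λ Fo → 𝟙 (((r + 0) ≡ᵇ u) ∧ (Fo ≡ᵇ m) ∧ holds G j ι)) (fixedOutR-inside ι) ⟩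
        𝟙 (((r + 0) ≡ᵇ u) ∧ (0 ≡ᵇ m) ∧ holds G j ι)
          ≡⟨ 𝟙-split ((r + 0) ≡ᵇ u) (0 ≡ᵇ m) (holds G j ι) ⟩
        δ u m * 𝟙 (holds G j ι) ∎
        where
        ι = identity (r + 0)
        only : ∀ {σ} → σ ∈ perms (r + 0) → T (Sep.Holds G u m j σ) → σ ≡ ι
        only {σ} σ∈ t = separated⇒identity σ (to ∈-perms σ∈) (proj₁ (to (T-∧ {separated r σ})
          (proj₂ (to (T-∧ {fixedOutR r σ ≡ᵇ m}) (proj₂ (to (T-∧ {fixedInR r σ ≡ᵇ u}) t))))))

    counts-proportional : ∀ n u m j → D.Count F (r + n) u m j ≡ c * Sep.Count G (r + n) u m j
    counts-proportional = proportional (λ n → D.Count F (r + n)) (λ n → Sep.Count G (r + n)) c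
      (count-recurrence staysInside staysInside⊆R F) (count-recurrence fixedInside fixedInside⊆R (separatedᶠ ∧ᶠ G))
      λ u m j → begin
        D.Count F (r + 0) u m j                          ≡⟨ D-at-r u m j ⟩
        δ u m * count (holds F j) (perms (r + 0))        ≡⟨ cong (δ u m *_) (at-r j) ⟩
        δ u m * (c * 𝟙 (holds G j (identity (r + 0))))   ≡⟨ x∙yz≈y∙xz (δ u m) c _ ⟩
        c * (δ u m * 𝟙 (holds G j (identity (r + 0))))   ≡⟨ cong (c *_) (Sep-at-r u m j) ⟨
        c * Sep.Count G (r + 0) u m j                    ∎

∧-rotate : ∀ s a b e → (s ∧ a ∧ b) ∧ e ≡ a ∧ b ∧ (s ∧ e)
∧-rotate true  a     b     e = ∧-assoc a b e
∧-rotate false false b     e = refl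
∧-rotate false true  false e = refl
∧-rotate false true  true  e = refl

countPerms-∧-true : ∀ N (P : Table N → Bool) → countPerms N P ≡ countPerms N (λ σ → P σ ∧ true)
countPerms-∧-true N P = trans (length-filter-T? P (perms N))
  (trans (count-cong (perms N) (λ σ → sym (∧-identityʳ (P σ)))) (sym (length-filter-T? _ (perms N))))

count-cyclesMeeting : ∀ r k → count (λ σ → cyclesMeeting r σ ≡ᵇ k) (perms (r + 0)) ≡ stirling1 r k
count-cyclesMeeting r k = trans (cong (λ M → count (λ σ → cyclesMeeting r σ ≡ᵇ k) (perms M)) (+-identityʳ r))
                                (sym (length-filter-T? _ (perms r)))

count-cycles-parity : ∀ r k j →
  count (λ σ → (cyclesMeeting r σ ≡ᵇ k) ∧ (par σ ≡ᵇ j % 2)) (perms (r + 0)) ≡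
  stirling1 r k * 𝟙 (par (identity (r + 0)) ≡ᵇ (r + k + j) % 2)
count-cycles-parity r k j = begin
  count (λ σ → (cycles σ ≡ᵇ k) ∧ (par σ ≡ᵇ j % 2)) (perms (r + 0))
    ≡⟨ sum-map-cong (perms (r + 0)) (λ {σ} σ∈ → pinned σ (to (∈-perms {σ = σ}) σ∈)) ⟩
  sum (map (λ σ → b * 𝟙 (cycles σ ≡ᵇ k)) (perms (r + 0)))
    ≡⟨ sum-map-* (perms (r + 0)) b (λ σ → 𝟙 (cycles σ ≡ᵇ k)) ⟩
  b * count (λ σ → cycles σ ≡ᵇ k) (perms (r + 0))
    ≡⟨ *-comm b _ ⟩
  count (λ σ → cycles σ ≡ᵇ k) (perms (r + 0)) * b
    ≡⟨ cong₂ _*_ (count-cyclesMeeting r k) parity-of-identity ⟩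
  stirling1 r k * 𝟙 (par (identity (r + 0)) ≡ᵇ (r + k + j) % 2) ∎
  where
  cycles : Table (r + 0) → ℕ
  cycles = cyclesMeeting r
  b = 𝟙 ((r + k) % 2 ≡ᵇ j % 2)
  pinned : ∀ σ → IsPerm σ → 𝟙 ((cycles σ ≡ᵇ k) ∧ (par σ ≡ᵇ j % 2)) ≡ b * 𝟙 (cycles σ ≡ᵇ k)
  pinned σ σ! = begin
    𝟙 ((cycles σ ≡ᵇ k) ∧ (par σ ≡ᵇ j % 2))    ≡⟨ 𝟙-∧ (cycles σ ≡ᵇ k) _ ⟩
    𝟙 (cycles σ ≡ᵇ k) * 𝟙 (par σ ≡ᵇ j % 2)    ≡⟨ *-comm (𝟙 (cycles σ ≡ᵇ k)) _ ⟩
    𝟙 (par σ ≡ᵇ j % 2) * 𝟙 (cycles σ ≡ᵇ k)    ≡⟨ *-𝟙-pin (cycles σ ≡ᵇ k) (cong (λ q → 𝟙 (q ≡ᵇ j % 2)) ∘ par≡r+k) ⟩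
    b * 𝟙 (cycles σ ≡ᵇ k)                     ∎
    where
    par≡r+k : T (cycles σ ≡ᵇ k) → par σ ≡ (r + k) % 2
    par≡r+k t = begin
      par σ                       ≡⟨ par≡cycles σ σ! ⟩
      (r + 0 + numCycles σ) % 2
        ≡⟨ cong₂ (λ a c → (a + c) % 2) (+-identityʳ r) (sym (cyclesMeeting-≥ r σ (≤-reflexive (+-identityʳ r)))) ⟩
      (r + cycles σ) % 2          ≡⟨ cong (λ c → (r + c) % 2) (≡ᵇ⇒≡ (cycles σ) k t) ⟩
      (r + k) % 2                 ∎
  parity-of-identity : b ≡ 𝟙 (par (identity (r + 0)) ≡ᵇ (r + k + j) % 2)
  parity-of-identity = cong 𝟙 (trans (≡ᵇ-%2 (r + k) j) (cong (_≡ᵇ (r + k + j) % 2) (sym (par-identity (r + 0)))))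

module _ (r u m n : ℕ) where

  countPerms-inD : (e : Table (r + n) → Bool) → countPerms (r + n) (λ σ → inD r u m n σ ∧ e σ) ≡
    count (λ σ → (stayInR r σ ≡ᵇ u) ∧ (fixedOutR r σ ≡ᵇ m) ∧ e σ) (perms (r + n))
  countPerms-inD e = trans (length-filter-T? _ (perms (r + n)))
    (count-cong (perms (r + n)) (λ σ → ∧-assoc (stayInR r σ ≡ᵇ u) (fixedOutR r σ ≡ᵇ m) (e σ)))

  countPerms-inDsep : (e : Table (r + n) → Bool) → countPerms (r + n) (λ σ → inDsep r u m n σ ∧ e σ) ≡
    count (λ σ → (fixedInR r σ ≡ᵇ u) ∧ (fixedOutR r σ ≡ᵇ m) ∧ (separated r σ ∧ e σ)) (perms (r + n))
  countPerms-inDsep e = trans (length-filter-T? _ (perms (r + n)))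
    (count-cong (perms (r + n)) (λ σ → ∧-rotate (separated r σ) (fixedInR r σ ≡ᵇ u) (fixedOutR r σ ≡ᵇ m) (e σ)))

  Dsep-count : ∀ j → Dsep r u m n ≡ Sep.Count r always (r + n) u m j
  Dsep-count _ = trans (countPerms-∧-true (r + n) (inDsep r u m n)) (countPerms-inDsep (const true))

  Dk-formula : ∀ k → Dk k r u m n ≡ stirling1 r k * Dsep r u m n
  Dk-formula k = begin
    Dk k r u m n                                         ≡⟨ countPerms-inD _ ⟩
    D.Count r (cyclesMeetingIs k) (r + n) u m 0
      ≡⟨ counts-proportional r (cyclesMeetingIs k) always (stirling1 r k) at-r n u m 0 ⟩
    stirling1 r k * Sep.Count r always (r + n) u m 0     ≡⟨ cong (stirling1 r k *_) (Dsep-count 0) ⟨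
    stirling1 r k * Dsep r u m n                         ∎
    where
    at-r : ∀ j → count (λ σ → cyclesMeeting r σ ≡ᵇ k) (perms (r + 0)) ≡ stirling1 r k * 1
    at-r _ = trans (count-cyclesMeeting r k) (sym (*-identityʳ _))

  D-formula : D r u m n ≡ r ! * Dsep r u m n
  D-formula = begin
    D r u m n
      ≡⟨ trans (countPerms-∧-true (r + n) (inD r u m n)) (countPerms-inD (const true)) ⟩
    D.Count r always (r + n) u m 0            ≡⟨ counts-proportional r always always (r !) at-r n u m 0 ⟩
    r ! * Sep.Count r always (r + n) u m 0    ≡⟨ cong (r ! *_) (Dsep-count 0) ⟨
    r ! * Dsep r u m n                        ∎
    where
    at-r : ∀ j → count (const true) (perms (r + 0)) ≡ r ! * 1
    at-r _ = trans (count-perms (r + 0)) (trans (cong _! (+-identityʳ r)) (sym (*-identityʳ _)))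

  Dpar-formula-≥2 : ∀ j → r ≥ 2 → Dpar (j % 2) r u m n ≡ (r ! / 2) * Dsep r u m n
  Dpar-formula-≥2 j r≥2 = begin
    Dpar (j % 2) r u m n                            ≡⟨ countPerms-inD _ ⟩
    D.Count r (parityIs 0) (r + n) u m j            ≡⟨ counts-proportional r (parityIs 0) always (r ! / 2) at-r n u m j ⟩
    (r ! / 2) * Sep.Count r always (r + n) u m j    ≡⟨ cong (r ! / 2 *_) (Dsep-count j) ⟨
    (r ! / 2) * Dsep r u m n                        ∎
    where
    at-r : ∀ j → parityCount (r + 0) j ≡ (r ! / 2) * 1
    at-r j = trans (parityCount-half (r + 0) j (≤-trans r≥2 (m≤m+n r 0)))
                   (trans (cong (λ M → M ! / 2) (+-identityʳ r)) (sym (*-identityʳ _)))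

  Dpar-formula-≤1 : ∀ j → r ≤ 1 → Dpar (j % 2) r u m n ≡ Dseppar (j % 2) r u m n
  Dpar-formula-≤1 j r≤1 = begin
    Dpar (j % 2) r u m n                           ≡⟨ countPerms-inD _ ⟩
    D.Count r (parityIs 0) (r + n) u m j           ≡⟨ counts-proportional r (parityIs 0) (parityIs 0) 1 (at-r r≤1) n u m j ⟩
    1 * Sep.Count r (parityIs 0) (r + n) u m j     ≡⟨ *-identityˡ _ ⟩
    Sep.Count r (parityIs 0) (r + n) u m j         ≡⟨ countPerms-inDsep _ ⟨
    Dseppar (j % 2) r u m n                        ∎
    where
    -- For r ≤ 1 the identity is the only permutation, and both sides evaluate.
    at-r : r ≤ 1 → ∀ j → parityCount (r + 0) j ≡ 1 * 𝟙 (par (identity (r + 0)) ≡ᵇ j % 2)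
    at-r z≤n       j = refl
    at-r (s≤s z≤n) j = refl

  Dkpar-formula : ∀ k j → Dkpar (j % 2) k r u m n ≡ stirling1 r k * Dseppar ((r + k + j) % 2) r u m n
  Dkpar-formula k j = begin
    Dkpar (j % 2) k r u m n                                          ≡⟨ countPerms-inD _ ⟩
    D.Count r (cyclesMeetingIs k ∧ᶠ parityIs 0) (r + n) u m j
      ≡⟨ counts-proportional r (cyclesMeetingIs k ∧ᶠ parityIs 0) (parityIs (r + k)) (stirling1 r k) (count-cycles-parity r k) n u m j ⟩
    stirling1 r k * Sep.Count r (parityIs (r + k)) (r + n) u m j     ≡⟨ cong (stirling1 r k *_) (countPerms-inDsep _) ⟨
    stirling1 r k * Dseppar ((r + k + j) % 2) r u m n                ∎

theorem4p1 : (r u m n k i : ℕ) → i < 2 →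
    (Dk k r u m n ≡ stirling1 r k * Dsep r u m n)
    × (D r u m n ≡ r ! * Dsep r u m n)
    × (r ≥ 2 → Dpar i r u m n ≡ (r ! / 2) * Dsep r u m n)
    × (r ≤ 1 → Dpar i r u m n ≡ Dseppar i r u m n)
    × (Dkpar i k r u m n ≡ stirling1 r k * Dseppar ((r + k + i) % 2) r u m n)
theorem4p1 r u m n k i i<2 =
    Dk-formula r u m n k
  , D-formula r u m n
  , (λ r≥2 → subst (λ i′ → Dpar i′ r u m n ≡ (r ! / 2) * Dsep r u m n) i%2≡i (Dpar-formula-≥2 r u m n i r≥2))
  , (λ r≤1 → subst (λ i′ → Dpar i′ r u m n ≡ Dseppar i′ r u m n) i%2≡i (Dpar-formula-≤1 r u m n i r≤1))
  , subst (λ i′ → Dkpar i′ k r u m n ≡ stirling1 r k * Dseppar ((r + k + i) % 2) r u m n) i%2≡i (Dkpar-formula r u m n k i)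
  where
  i%2≡i : i % 2 ≡ i
  i%2≡i = m<n⇒m%n≡m i<2
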